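{- Let $p_1\ne p_2$ be primes, let $Q\ge0$ and $N\ge2$ be integers, let $n=[\log_2N]+1$, and let $\mathbf x=(x_1,x_2)\in[0,1)^2$ with base-$p_i$ expansions $x_i=\sum_{j\ge1}x_{i,j}p_i^{ -j}$, $x_{i,j}\in\{0,\dots,p_i-1\}$. Let $[\mathbf x]_{(n,n)}=([x_1]_n,[x_2]_n)$ where $[x_i]_n=\sum_{1\le j\le n}x_{i,j}p_i^{ -j}$, and set $\mathcal D(N)=D\big([\mathbf x]_{(n,n)},(H_2(k))_{k=Q}^{Q+N-1}\big)$. For $\mathbf r=(r_1,r_2)$ with $r_1,r_2\ge1$ put $P_{\mathbf r}=p_1^{r_1}p_2^{r_2}$ and $$\mathcal D_{\mathbf r,N}=\sum_{b_1=0}^{x_{1,r_1}-1}\sum_{b_2=0}^{x_{2,r_2}-1}\sum_{k=Q}^{Q+N-1}\Big(\delta_{P_{\mathbf r}}(k-X_{\mathbf r,\mathbf b})-\frac1{P_{\mathbf r}}\Big),$$ where $\mathbf b=(b_1,b_2)$ and $X_{\mathbf r,\mathbf b}\in[0,P_{\mathbf r})$ is the integer with $$X_{\mathbf r,\mathbf b}\equiv M_{1,\mathbf r}\,p_2^{r_2}\Big(\sum_{1\le j<r_1}x_{1,j}p_1^{j-1}+b_1p_1^{r_1-1}\Big)+M_{2,\mathbf r}\,p_1^{r_1}\Big(\sum_{1\le j<r_2}x_{2,j}p_2^{j-1}+b_2p_2^{r_2-1}\Big)\pmod{P_{\mathbf r}}$$ (the sum defining $\mathcal D_{\mathbf r,N}$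 is empty, hence $0$, if $x_{1,r_1}=0$ or $x_{2,r_2}=0$). Then $$\mathcal D(N)=\sum_{r_1,r_2=1}^{n}\mathcal D_{\mathbf r,N}=D\big(\mathbf x,(H_2(k))_{k=Q}^{Q+N-1}\big)+2\epsilon\quad\text{for some }|\epsilon|\le1.$$ Furthermore, $|\mathcal D_{\mathbf r,N}|\le x_{1,r_1}x_{2,r_2}<p_1p_2$ for every $\mathbf r=(r_1,r_2)$ and every natural number $N$.
   Context: For $i\in\{1,2\}$ and an integer $k\ge0$ written as $k=\sum_{j\ge1}e_{i,j}(k)p_i^{j-1}$ with digits in $\{0,\dots,p_i-1\}$, let $\phi_i(k)=\sum_{j\ge1}e_{i,j}(k)p_i^{ -j}$ and $H_2(k)=(\phi_1(k),\phi_2(k))$. For a finite point sequence $\mathcal P=(\beta_k)$ in $[0,1)^2$ of $N$ points and $\mathbf y=(y_1,y_2)$, $D(\mathbf y,\mathcal P)=\#\{k:\beta_k\in[0,y_1)\times[0,y_2)\}-Ny_1y_2$. For an integer $M\ge1$, $\delta_M(a)=1$ if $a\equiv0\pmod M$ and $\delta_M(a)=0$ otherwise. For $\mathbf r=(r_1,r_2)$, $M_{1,\mathbf r}\in[0,p_1^{r_1})$ and $M_{2,\mathbf r}\in[0,p_2^{r_2})$ are the integers with $p_2^{r_2}M_{1,\mathbf r}\equiv1\pmod{p_1^{r_1}}$ and $p_1^{r_1}M_{2,\mathbf r}\equiv1\pmod{p_2^{r_2}}$. $[y]$ denotes the integer part of $y$. -}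

module Defs where

open import Data.Nat as ℕ using (ℕ; zero; suc; _^_; _∸_)
open import Data.Nat.DivMod using (_/_; _%_)
open import Data.Nat.Divisibility using (_∣?_)
open import Data.Integer as ℤ using (ℤ; +_)
open import Data.Rational as ℚ using (ℚ; 0ℚ; 1ℚ)
open import Data.Rational.Properties using (_<?_)
open import Data.List using (List; []; _∷_; map; upTo; length)
open import Data.Product using (_×_; _,_; proj₁; proj₂)
open import Relation.Nullary using (yes; no)

fromℕ : ℕ → ℚ
fromℕ n = (+ n) ℚ./ 1

-- 1/m as a rational (only ever used with m ≠ 0; the zero case is a dummy)
inv : ℕ → ℚ
inv zero    = 0ℚ
inv (suc m) = (+ 1) ℚ./ suc m

-- a mod m (only ever used with m ≠ 0; the zero case is a dummy)
mod : ℕ → ℕ → ℕ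
mod a zero    = a
mod a (suc m) = a % suc m

-- finite sums  Σ_{i=a}^{b} f i  (empty if b < a)
Σℚ[_⋯_] : ℕ → ℕ → (ℕ → ℚ) → ℚ
Σℚ[ a ⋯ b ] f = go (suc b ∸ a)
  where
  go : ℕ → ℚ
  go zero    = 0ℚ
  go (suc t) = go t ℚ.+ f (a ℕ.+ t)

sumBelow : ℕ → (ℕ → ℚ) → ℚ
sumBelow zero  f = 0ℚ
sumBelow (suc c) f = sumBelow c f ℚ.+ f c

Σℕ[_⋯_] : ℕ → ℕ → (ℕ → ℕ) → ℕ
Σℕ[ a ⋯ b ] f = go (suc b ∸ a)
  where
  go : ℕ → ℕ
  go zero    = 0
  go (suc t) = go t ℕ.+ f (a ℕ.+ t)

-- integer division a / m (only ever used with m ≠ 0; the zero case is a dummy)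
div : ℕ → ℕ → ℕ
div a zero    = a
div a (suc m) = a / suc m

-- j-th base-p digit e_{j}(k) of k (j ≥ 1), i.e. k = Σ_{j≥1} e_j(k) p^{j-1}
digit : (p k j : ℕ) → ℕ
digit p k j = mod (div k (p ^ (j ∸ 1))) p

-- radical inverse φ_p(k) = Σ_{j≥1} e_j(k) p^{-j}; for p ≥ 2 all digits
-- e_j(k) with j > k vanish, so the sum over 1 ≤ j ≤ k is the full sum.
φ : (p k : ℕ) → ℚ
φ p k = Σℚ[ 1 ⋯ k ] (λ j → fromℕ (digit p k j) ℚ.* inv (p ^ j))

H₂ : (p₁ p₂ k : ℕ) → ℚ × ℚ
H₂ p₁ p₂ k = φ p₁ k , φ p₂ k

haltonSeg : (p₁ p₂ Q N : ℕ) → List (ℚ × ℚ)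
haltonSeg p₁ p₂ Q N = map (λ i → H₂ p₁ p₂ (Q ℕ.+ i)) (upTo N)

-- #{k : β_k ∈ [0,y₁) × [0,y₂)}  (points lie in [0,1)^2, so only upper bounds matter)
count : ℚ × ℚ → List (ℚ × ℚ) → ℕ
count y [] = 0
count y ((b₁ , b₂) ∷ bs) with b₁ <? proj₁ y | b₂ <? proj₂ y
... | yes _ | yes _ = suc (count y bs)
... | _     | _     = count y bs

D : ℚ × ℚ → List (ℚ × ℚ) → ℚ
D y P = fromℕ (count y P) ℚ.- fromℕ (length P) ℚ.* proj₁ y ℚ.* proj₂ y

trunc : (p : ℕ) → (ℕ → ℕ) → ℕ → ℚ
trunc p x n = Σℚ[ 1 ⋯ n ] (λ j → fromℕ (x j) ℚ.* inv (p ^ j))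

δ : ℕ → ℤ → ℚ
δ M a with M ∣? ℤ.∣ a ∣
... | yes _ = 1ℚ
... | no  _ = 0ℚ

X : (p₁ p₂ : ℕ) (x₁ x₂ : ℕ → ℕ) (M₁ M₂ : ℕ) (r₁ r₂ b₁ b₂ : ℕ) → ℕ
X p₁ p₂ x₁ x₂ M₁ M₂ r₁ r₂ b₁ b₂ =
  mod (M₁ ℕ.* p₂ ^ r₂ ℕ.* (Σℕ[ 1 ⋯ r₁ ∸ 1 ] (λ j → x₁ j ℕ.* p₁ ^ (j ∸ 1)) ℕ.+ b₁ ℕ.* p₁ ^ (r₁ ∸ 1))
       ℕ.+ M₂ ℕ.* p₁ ^ r₁ ℕ.* (Σℕ[ 1 ⋯ r₂ ∸ 1 ] (λ j → x₂ j ℕ.* p₂ ^ (j ∸ 1)) ℕ.+ b₂ ℕ.* p₂ ^ (r₂ ∸ 1)))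
      (p₁ ^ r₁ ℕ.* p₂ ^ r₂)

𝒟r : (p₁ p₂ : ℕ) (x₁ x₂ : ℕ → ℕ) (M₁ M₂ : ℕ → ℕ → ℕ) (Q N r₁ r₂ : ℕ) → ℚ
𝒟r p₁ p₂ x₁ x₂ M₁ M₂ Q N r₁ r₂ =
  sumBelow (x₁ r₁) λ b₁ → sumBelow (x₂ r₂) λ b₂ → sumBelow N λ i →
    δ P ((+ (Q ℕ.+ i)) ℤ.- (+ X p₁ p₂ x₁ x₂ (M₁ r₁ r₂) (M₂ r₁ r₂) r₁ r₂ b₁ b₂)) ℚ.- inv P
  where
  P : ℕ
  P = p₁ ^ r₁ ℕ.* p₂ ^ r₂

{-# OPTIONS --safe #-}
-- Comparing φ_p(k) with [x]_n is a lexicographic comparison of base-p digits, so the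
-- indicator of φ_p(k) < [x]_n is a sum over the first digit s + 1 at which the digits
-- of k fall below those of x; that event says k ≡ Σ_{j≤s} x_j p^(j-1) + b p^s
-- (mod p^(s+1)) for some b < x_(s+1). Multiplying the two coordinates and merging the two
-- congruences by the Chinese remainder theorem (M₁, M₂ are the CRT inverses) writes the
-- number of points in the box as Σ_r Σ_b Σ_k δ_{P_r}(k − X_{r,b}); expanding the box area
-- [x₁]_n [x₂]_n the same way produces the terms 1/P_r. Each sum over k counts the hits of
-- one residue class in a window of N consecutive integers, which is within 1 of N/P_r;
-- this gives |𝒟_{r,N}| ≤ x_{1,r₁} x_{2,r₂}. Finally, as N ≤ p_i^n, enlarging the box
-- from [x]_n to [x]_m adds at most one point per coordinate (the k whose first n digits
-- are those of x_i) and at most N (p₁^(-n) + p₂^(-n)) ≤ 2 to the expected count.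
module Submission where

module Rationals where

  open import Defs using (fromℕ; inv)
  open import Data.Nat as ℕ using (ℕ; zero; suc; NonZero)
  import Data.Nat.Properties as ℕ
  open import Data.Nat.Coprimality using (1-coprimeTo) renaming (sym to coprime-sym)
  open import Data.Integer as ℤ using (+_)
  import Data.Integer.Properties as ℤ
  open import Data.Rational using (0ℚ; 1ℚ; mkℚ; Positive; nonNegative; _+_; _*_; _-_; -_; ∣_∣; _≤_; _<_; *≤*; *<*)
  open import Data.Rational.Properties
  open import Data.Rational.Solver using (module +-*-Solver)
  open import Data.Product using (_×_; _,_)
  open import Data.Sum using (inj₁; inj₂)
  open import Relation.Binary.PropositionalEquality
  open +-*-Solver using (solve; _:+_; _:*_; _:-_; :-_; _:=_; con)

  fromℕ≡mkℚ : ∀ n → fromℕ n ≡ mkℚ (+ n) 0 (coprime-sym (1-coprimeTo n))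
  fromℕ≡mkℚ n = normalize-coprime (coprime-sym (1-coprimeTo n))

  fromℕ-suc : ∀ n → fromℕ (suc n) ≡ fromℕ n + 1ℚ
  fromℕ-suc n rewrite fromℕ≡mkℚ n =
    trans (fromℕ≡mkℚ (suc n)) (sym (trans (/-cong {p₂ = + suc n} numerator refl) (fromℕ≡mkℚ (suc n))))
    where
    numerator : + n ℤ.* + 1 ℤ.+ + 1 ℤ.* + 1 ≡ + suc n
    numerator rewrite ℤ.*-identityʳ (+ n) = cong +_ (ℕ.+-comm n 1)

  fromℕ-+ : ∀ m n → fromℕ (m ℕ.+ n) ≡ fromℕ m + fromℕ n
  fromℕ-+ zero    n = sym (+-identityˡ (fromℕ n))
  fromℕ-+ (suc m) n rewrite fromℕ-suc (m ℕ.+ n) | fromℕ-+ m n | fromℕ-suc m =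
    solve 2 (λ x y → (x :+ y) :+ con 1ℚ := (x :+ con 1ℚ) :+ y) refl (fromℕ m) (fromℕ n)

  fromℕ-* : ∀ m n → fromℕ (m ℕ.* n) ≡ fromℕ m * fromℕ n
  fromℕ-* zero    n = sym (*-zeroˡ (fromℕ n))
  fromℕ-* (suc m) n rewrite fromℕ-+ n (m ℕ.* n) | fromℕ-* m n | fromℕ-suc m =
    solve 2 (λ x y → y :+ x :* y := (x :+ con 1ℚ) :* y) refl (fromℕ m) (fromℕ n)

  fromℕ-mono-≤ : ∀ {m n} → m ℕ.≤ n → fromℕ m ≤ fromℕ n
  fromℕ-mono-≤ {m} {n} m≤n rewrite fromℕ≡mkℚ m | fromℕ≡mkℚ n =
    *≤* (subst₂ ℤ._≤_ (sym (ℤ.*-identityʳ (+ m))) (sym (ℤ.*-identityʳ (+ n))) (ℤ.+≤+ m≤n))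

  fromℕ-mono-< : ∀ {m n} → m ℕ.< n → fromℕ m < fromℕ n
  fromℕ-mono-< {m} {n} m<n rewrite fromℕ≡mkℚ m | fromℕ≡mkℚ n =
    *<* (subst₂ ℤ._<_ (sym (ℤ.*-identityʳ (+ m))) (sym (ℤ.*-identityʳ (+ n))) (ℤ.+<+ m<n))

  fromℕ-cancel-< : ∀ {m n} → fromℕ m < fromℕ n → m ℕ.< n
  fromℕ-cancel-< {m} {n} m<n rewrite fromℕ≡mkℚ m | fromℕ≡mkℚ n with m<n
  ... | *<* lt with subst₂ ℤ._<_ (ℤ.*-identityʳ (+ m)) (ℤ.*-identityʳ (+ n)) lt
  ...   | ℤ.+<+ m<ₙn = m<ₙn

  fromℕ-nonNeg : ∀ n → 0ℚ ≤ fromℕ n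
  fromℕ-nonNeg n = fromℕ-mono-≤ {0} {n} ℕ.z≤n

  inv-inverseˡ : ∀ m .{{_ : NonZero m}} → inv m * fromℕ m ≡ 1ℚ
  inv-inverseˡ (suc m) rewrite fromℕ≡mkℚ (suc m) | normalize-coprime {1} {m} (1-coprimeTo (suc m)) =
    *-inverseˡ (mkℚ (+ suc m) 0 (coprime-sym (1-coprimeTo (suc m))))

  inv-inverseʳ : ∀ m .{{_ : NonZero m}} → fromℕ m * inv m ≡ 1ℚ
  inv-inverseʳ m = trans (*-comm (fromℕ m) (inv m)) (inv-inverseˡ m)

  inv-pos : ∀ m .{{_ : NonZero m}} → Positive (inv m)
  inv-pos (suc m) rewrite normalize-coprime {1} {m} (1-coprimeTo (suc m)) = _

  -- Including the junk value inv 0 = 0.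
  inv-nonNeg : ∀ m → 0ℚ ≤ inv m
  inv-nonNeg zero    = ≤-refl
  inv-nonNeg (suc m) = <⇒≤ (positive⁻¹ (inv (suc m)) {{inv-pos (suc m)}})

  inv-unique : ∀ m .{{_ : NonZero m}} x → x * fromℕ m ≡ 1ℚ → x ≡ inv m
  inv-unique m x x*m≡1 = begin
    x                          ≡⟨ sym (*-identityʳ x) ⟩
    x * 1ℚ                     ≡⟨ cong (x *_) (sym (inv-inverseʳ m)) ⟩
    x * (fromℕ m * inv m)      ≡⟨ sym (*-assoc x _ _) ⟩
    x * fromℕ m * inv m        ≡⟨ cong (_* inv m) x*m≡1 ⟩
    1ℚ * inv m                 ≡⟨ *-identityˡ (inv m) ⟩
    inv m                      ∎
    where open ≡-Reasoning

  inv-* : ∀ m n .{{_ : NonZero m}} .{{_ : NonZero n}} → inv (m ℕ.* n) ≡ inv m * inv n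
  inv-* m n = sym (inv-unique (m ℕ.* n) {{ℕ.m*n≢0 m n}} (inv m * inv n) (begin
    inv m * inv n * fromℕ (m ℕ.* n)            ≡⟨ cong (inv m * inv n *_) (fromℕ-* m n) ⟩
    inv m * inv n * (fromℕ m * fromℕ n)        ≡⟨ solve 4 (λ a b c d → a :* b :* (c :* d) := (a :* c) :* (b :* d))
                                                     refl (inv m) (inv n) (fromℕ m) (fromℕ n) ⟩
    (inv m * fromℕ m) * (inv n * fromℕ n)      ≡⟨ cong₂ _*_ (inv-inverseˡ m) (inv-inverseˡ n) ⟩
    1ℚ * 1ℚ                                    ≡⟨ *-identityˡ 1ℚ ⟩
    1ℚ                                         ∎))
    where open ≡-Reasoning

  fromℕ*inv-nonNeg : ∀ a m → 0ℚ ≤ fromℕ a * inv m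
  fromℕ*inv-nonNeg a m = nonNegative⁻¹ _
    {{nonNeg*nonNeg⇒nonNeg (fromℕ a) {{nonNegative (fromℕ-nonNeg a)}} (inv m) {{nonNegative (inv-nonNeg m)}}}}

  fromℕ*inv≤1 : ∀ {a} m .{{_ : NonZero m}} → a ℕ.≤ m → fromℕ a * inv m ≤ 1ℚ
  fromℕ*inv≤1 m a≤m = ≤-trans (*-monoʳ-≤-nonNeg (inv m) {{nonNegative (inv-nonNeg m)}} (fromℕ-mono-≤ a≤m))
                              (≤-reflexive (inv-inverseʳ m))

  p≤p+q : ∀ p {q} → 0ℚ ≤ q → p ≤ p + q
  p≤p+q p {q} 0≤q = ≤-trans (≤-reflexive (sym (+-identityʳ p))) (+-monoʳ-≤ p 0≤q)

  ∣p-q∣≤r : ∀ {p q r} → 0ℚ ≤ p → p ≤ r → 0ℚ ≤ q → q ≤ r → ∣ p - q ∣ ≤ r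
  ∣p-q∣≤r {p} {q} {r} 0≤p p≤r 0≤q q≤r with ∣p∣≡p∨∣p∣≡-p (p - q)
  ... | inj₁ ∣p-q∣≡p-q = begin
    ∣ p - q ∣   ≡⟨ ∣p-q∣≡p-q ⟩
    p - q       ≤⟨ +-monoʳ-≤ p (neg-antimono-≤ 0≤q) ⟩
    p - 0ℚ      ≡⟨ +-identityʳ p ⟩
    p           ≤⟨ p≤r ⟩
    r           ∎
    where open ≤-Reasoning
  ... | inj₂ ∣p-q∣≡q-p = begin
    ∣ p - q ∣   ≡⟨ ∣p-q∣≡q-p ⟩
    - (p - q)   ≡⟨ solve 2 (λ p q → :- (p :- q) := q :- p) refl p q ⟩
    q - p       ≤⟨ +-monoʳ-≤ q (neg-antimono-≤ 0≤p) ⟩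
    q - 0ℚ      ≡⟨ +-identityʳ q ⟩
    q           ≤⟨ q≤r ⟩
    r           ∎
    where open ≤-Reasoning

  *-mono-[0,1] : ∀ {p q} → 0ℚ ≤ p → p ≤ 1ℚ → 0ℚ ≤ q → q ≤ 1ℚ → 0ℚ ≤ p * q × p * q ≤ 1ℚ
  *-mono-[0,1] {p} {q} 0≤p p≤1 0≤q q≤1 =
      nonNegative⁻¹ _ {{nonNeg*nonNeg⇒nonNeg p {{nonNegative 0≤p}} q {{nonNegative 0≤q}}}}
    , ≤-trans (*-monoʳ-≤-nonNeg q {{nonNegative 0≤q}} p≤1) (≤-trans (≤-reflexive (*-identityˡ q)) q≤1)

module FiniteSums where

  open import Defs using (fromℕ; sumBelow; Σℚ[_⋯_]; Σℕ[_⋯_])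
  open Rationals
  open import Data.Nat as ℕ using (ℕ; zero; suc; _∸_)
  import Data.Nat.Properties as ℕ
  open import Data.Rational using (ℚ; 0ℚ; 1ℚ; _+_; _*_; _-_; _≤_; ∣_∣)
  open import Data.Rational.Properties
  open import Data.Rational.Solver using (module +-*-Solver)
  open import Algebra.Bundles using (CommutativeMonoid)
  open import Algebra.Properties.CommutativeSemigroup (CommutativeMonoid.commutativeSemigroup +-0-commutativeMonoid)
    using () renaming (interchange to ℚ-interchange)
  open import Algebra.Properties.CommutativeSemigroup ℕ.+-commutativeSemigroup using () renaming (interchange to ℕ-interchange)
  open import Relation.Binary.PropositionalEquality
  open +-*-Solver using (solve; _:+_; _:*_; _:-_; _:=_; con)

  sumBelowℕ : ℕ → (ℕ → ℕ) → ℕ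
  sumBelowℕ zero    f = 0
  sumBelowℕ (suc c) f = sumBelowℕ c f ℕ.+ f c

  private
    ℕ-induction : ∀ {ℓ} {P : ℕ → Set ℓ} → P 0 → (∀ n → P n → P (suc n)) → ∀ n → P n
    ℕ-induction base step zero    = base
    ℕ-induction base step (suc n) = step n (ℕ-induction base step n)

  -- Σℚ[_⋯_] recurses through a local function on the length suc b ∸ a;
  -- abstracting that length lets unification find the induction motive.
  Σℚ≡sumBelow : ∀ a b f → Σℚ[ a ⋯ b ] f ≡ sumBelow (suc b ∸ a) (λ i → f (a ℕ.+ i))
  Σℚ≡sumBelow a b f with suc b ∸ a | ℕ-induction {P = _}
  ... | len | induction = induction refl (λ t → cong (_+ f (a ℕ.+ t))) len

  Σℕ≡sumBelowℕ : ∀ a b f → Σℕ[ a ⋯ b ] f ≡ sumBelowℕ (suc b ∸ a) (λ i → f (a ℕ.+ i))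
  Σℕ≡sumBelowℕ a b f with suc b ∸ a | ℕ-induction {P = _}
  ... | len | induction = induction refl (λ t → cong (ℕ._+ f (a ℕ.+ t))) len

  sumBelow-cong : ∀ c {f g : ℕ → ℚ} → (∀ i → i ℕ.< c → f i ≡ g i) → sumBelow c f ≡ sumBelow c g
  sumBelow-cong zero    f≡g = refl
  sumBelow-cong (suc c) f≡g = cong₂ _+_ (sumBelow-cong c (λ i i<c → f≡g i (ℕ.m<n⇒m<1+n i<c))) (f≡g c ℕ.≤-refl)

  sumBelow-distrib-+ : ∀ c f g → sumBelow c (λ i → f i + g i) ≡ sumBelow c f + sumBelow c g
  sumBelow-distrib-+ zero    f g = refl
  sumBelow-distrib-+ (suc c) f g rewrite sumBelow-distrib-+ c f g =
    ℚ-interchange (sumBelow c f) (sumBelow c g) (f c) (g c)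

  sumBelow-distrib-- : ∀ c f g → sumBelow c (λ i → f i - g i) ≡ sumBelow c f - sumBelow c g
  sumBelow-distrib-- zero    f g = refl
  sumBelow-distrib-- (suc c) f g rewrite sumBelow-distrib-- c f g =
    solve 4 (λ a b x y → (a :- b) :+ (x :- y) := (a :+ x) :- (b :+ y)) refl (sumBelow c f) (sumBelow c g) (f c) (g c)

  sumBelow-const : ∀ c a → sumBelow c (λ _ → a) ≡ fromℕ c * a
  sumBelow-const zero    a = sym (*-zeroˡ a)
  sumBelow-const (suc c) a rewrite sumBelow-const c a | fromℕ-suc c =
    solve 2 (λ x a → x :* a :+ a := (x :+ con 1ℚ) :* a) refl (fromℕ c) a

  sumBelow-zero : ∀ c {f} → (∀ i → i ℕ.< c → f i ≡ 0ℚ) → sumBelow c f ≡ 0ℚ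
  sumBelow-zero c f≡0 = trans (sumBelow-cong c f≡0) (trans (sumBelow-const c 0ℚ) (*-zeroʳ (fromℕ c)))

  *-distribˡ-sumBelow : ∀ c a f → a * sumBelow c f ≡ sumBelow c (λ i → a * f i)
  *-distribˡ-sumBelow zero    a f = *-zeroʳ a
  *-distribˡ-sumBelow (suc c) a f = trans (*-distribˡ-+ a (sumBelow c f) (f c)) (cong (_+ a * f c) (*-distribˡ-sumBelow c a f))

  *-distribʳ-sumBelow : ∀ c a f → sumBelow c f * a ≡ sumBelow c (λ i → f i * a)
  *-distribʳ-sumBelow zero    a f = *-zeroˡ a
  *-distribʳ-sumBelow (suc c) a f = trans (*-distribʳ-+ a (sumBelow c f) (f c)) (cong (_+ f c * a) (*-distribʳ-sumBelow c a f))

  sumBelow-*-sumBelow : ∀ m n f g → sumBelow m f * sumBelow n g ≡ sumBelow m (λ i → sumBelow n (λ j → f i * g j))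
  sumBelow-*-sumBelow m n f g =
    trans (*-distribʳ-sumBelow m (sumBelow n g) f) (sumBelow-cong m (λ i _ → *-distribˡ-sumBelow n (f i) g))

  sumBelow-comm : ∀ c d (f : ℕ → ℕ → ℚ) →
    sumBelow c (λ i → sumBelow d (λ j → f i j)) ≡ sumBelow d (λ j → sumBelow c (λ i → f i j))
  sumBelow-comm zero    d f = sym (sumBelow-zero d (λ _ _ → refl))
  sumBelow-comm (suc c) d f rewrite sumBelow-comm c d f = sym (sumBelow-distrib-+ d (λ j → sumBelow c (λ i → f i j)) (f c))

  sumBelow-split : ∀ n t f → sumBelow (n ℕ.+ t) f ≡ sumBelow n f + sumBelow t (λ s → f (n ℕ.+ s))
  sumBelow-split n zero    f rewrite ℕ.+-identityʳ n = sym (+-identityʳ _)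
  sumBelow-split n (suc t) f rewrite ℕ.+-suc n t | sumBelow-split n t f = +-assoc (sumBelow n f) _ _

  sumBelow-pad : ∀ n t f → (∀ s → s ℕ.< t → f (n ℕ.+ s) ≡ 0ℚ) → sumBelow (n ℕ.+ t) f ≡ sumBelow n f
  sumBelow-pad n t f tail≡0 =
    trans (sumBelow-split n t f) (trans (cong (sumBelow n f +_) (sumBelow-zero t tail≡0)) (+-identityʳ _))

  sumBelow-nonNeg : ∀ c f → (∀ i → i ℕ.< c → 0ℚ ≤ f i) → 0ℚ ≤ sumBelow c f
  sumBelow-nonNeg zero    f f≥0 = ≤-refl
  sumBelow-nonNeg (suc c) f f≥0 = +-mono-≤ (sumBelow-nonNeg c f (λ i i<c → f≥0 i (ℕ.m<n⇒m<1+n i<c))) (f≥0 c ℕ.≤-refl)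

  ∣sumBelow∣≤ : ∀ c f B → (∀ i → i ℕ.< c → ∣ f i ∣ ≤ B) → ∣ sumBelow c f ∣ ≤ fromℕ c * B
  ∣sumBelow∣≤ zero    f B ∣f∣≤B = ≤-reflexive (sym (*-zeroˡ B))
  ∣sumBelow∣≤ (suc c) f B ∣f∣≤B = begin
    ∣ sumBelow c f + f c ∣      ≤⟨ ∣p+q∣≤∣p∣+∣q∣ (sumBelow c f) (f c) ⟩
    ∣ sumBelow c f ∣ + ∣ f c ∣  ≤⟨ +-mono-≤ (∣sumBelow∣≤ c f B (λ i i<c → ∣f∣≤B i (ℕ.m<n⇒m<1+n i<c))) (∣f∣≤B c ℕ.≤-refl) ⟩
    fromℕ c * B + B             ≡⟨ solve 2 (λ x a → x :* a :+ a := (x :+ con 1ℚ) :* a) refl (fromℕ c) B ⟩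
    (fromℕ c + 1ℚ) * B          ≡⟨ cong (_* B) (sym (fromℕ-suc c)) ⟩
    fromℕ (suc c) * B           ∎
    where open ≤-Reasoning

  sumBelowℕ-cong : ∀ c {f g : ℕ → ℕ} → (∀ i → i ℕ.< c → f i ≡ g i) → sumBelowℕ c f ≡ sumBelowℕ c g
  sumBelowℕ-cong zero    f≡g = refl
  sumBelowℕ-cong (suc c) f≡g = cong₂ ℕ._+_ (sumBelowℕ-cong c (λ i i<c → f≡g i (ℕ.m<n⇒m<1+n i<c))) (f≡g c ℕ.≤-refl)

  sumBelowℕ-mono-≤ : ∀ c {f g : ℕ → ℕ} → (∀ i → i ℕ.< c → f i ℕ.≤ g i) → sumBelowℕ c f ℕ.≤ sumBelowℕ c g
  sumBelowℕ-mono-≤ zero    f≤g = ℕ.z≤n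
  sumBelowℕ-mono-≤ (suc c) f≤g = ℕ.+-mono-≤ (sumBelowℕ-mono-≤ c (λ i i<c → f≤g i (ℕ.m<n⇒m<1+n i<c))) (f≤g c ℕ.≤-refl)

  sumBelowℕ-distrib-+ : ∀ c f g → sumBelowℕ c (λ i → f i ℕ.+ g i) ≡ sumBelowℕ c f ℕ.+ sumBelowℕ c g
  sumBelowℕ-distrib-+ zero    f g = refl
  sumBelowℕ-distrib-+ (suc c) f g rewrite sumBelowℕ-distrib-+ c f g =
    ℕ-interchange (sumBelowℕ c f) (sumBelowℕ c g) (f c) (g c)

  sumBelowℕ-head : ∀ c f → sumBelowℕ (suc c) f ≡ f 0 ℕ.+ sumBelowℕ c (λ i → f (suc i))
  sumBelowℕ-head zero    f = ℕ.+-comm 0 (f 0)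
  sumBelowℕ-head (suc c) f rewrite sumBelowℕ-head c f = ℕ.+-assoc (f 0) _ _

  sumBelowℕ-pad : ∀ n t f → (∀ s → s ℕ.< t → f (n ℕ.+ s) ≡ 0) → sumBelowℕ (n ℕ.+ t) f ≡ sumBelowℕ n f
  sumBelowℕ-pad n zero    f tail≡0 = cong (λ m → sumBelowℕ m f) (ℕ.+-identityʳ n)
  sumBelowℕ-pad n (suc t) f tail≡0 = begin
    sumBelowℕ (n ℕ.+ suc t) f           ≡⟨ cong (λ m → sumBelowℕ m f) (ℕ.+-suc n t) ⟩
    sumBelowℕ (n ℕ.+ t) f ℕ.+ f (n ℕ.+ t) ≡⟨ cong₂ ℕ._+_ (sumBelowℕ-pad n t f (λ s s<t → tail≡0 s (ℕ.m<n⇒m<1+n s<t))) (tail≡0 t ℕ.≤-refl) ⟩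
    sumBelowℕ n f ℕ.+ 0                 ≡⟨ ℕ.+-identityʳ _ ⟩
    sumBelowℕ n f                       ∎
    where open ≡-Reasoning

  fromℕ-sumBelowℕ : ∀ c f → fromℕ (sumBelowℕ c f) ≡ sumBelow c (λ i → fromℕ (f i))
  fromℕ-sumBelowℕ zero    f = refl
  fromℕ-sumBelowℕ (suc c) f = trans (fromℕ-+ (sumBelowℕ c f) (f c)) (cong (_+ fromℕ (f c)) (fromℕ-sumBelowℕ c f))

  fromℕ-sumBelowℕ² : ∀ n (c : ℕ → ℕ) (f : ℕ → ℕ → ℕ) →
    fromℕ (sumBelowℕ n (λ s → sumBelowℕ (c s) (f s))) ≡ sumBelow n (λ s → sumBelow (c s) (λ b → fromℕ (f s b)))
  fromℕ-sumBelowℕ² n c f = trans (fromℕ-sumBelowℕ n (λ s → sumBelowℕ (c s) (f s))) (sumBelow-cong n (λ s _ → fromℕ-sumBelowℕ (c s) (f s)))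

module Indicators where

  open FiniteSums using (sumBelowℕ)
  open import Level using (Level)
  open import Data.Nat as ℕ using (ℕ; zero; suc; _+_; _*_; _≤_; z≤n; s≤s; _<?_; _≟_)
  import Data.Nat.Properties as ℕ
  open import Data.Product using (_×_; _,_)
  open import Data.Sum as Sum using ([_,_])
  open import Function.Bundles using (_⇔_; mk⇔; Equivalence)
  open import Relation.Nullary using (Dec; yes; no; ¬_; contradiction)
  open import Relation.Nullary.Decidable using (_×-dec_; _⊎-dec_)
  open import Relation.Binary.PropositionalEquality hiding ([_])

  private
    variable
      ℓ₁ ℓ₂ ℓ₃ ℓ₄ ℓ₅ ℓ₆ : Level
      A : Set ℓ₁
      B : Set ℓ₂
      A′ : Set ℓ₃
      B′ : Set ℓ₄
      C : Set ℓ₅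
      C′ : Set ℓ₆

  𝟙 : Dec A → ℕ
  𝟙 (yes _) = 1
  𝟙 (no  _) = 0

  𝟙-yes : (d : Dec A) → A → 𝟙 d ≡ 1
  𝟙-yes (yes _) _ = refl
  𝟙-yes (no ¬x) x = contradiction x ¬x

  𝟙-no : (d : Dec A) → ¬ A → 𝟙 d ≡ 0
  𝟙-no (yes x) ¬x = contradiction x ¬x
  𝟙-no (no _)  _  = refl

  𝟙-cong : (da : Dec A) (db : Dec B) → A ⇔ B → 𝟙 da ≡ 𝟙 db
  𝟙-cong (yes x) db A⇔B = sym (𝟙-yes db (Equivalence.to A⇔B x))
  𝟙-cong (no ¬x) db A⇔B = sym (𝟙-no db (λ y → ¬x (Equivalence.from A⇔B y)))

  𝟙-× : (da : Dec A) (db : Dec B) → 𝟙 (da ×-dec db) ≡ 𝟙 da * 𝟙 db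
  𝟙-× (yes _) (yes _) = refl
  𝟙-× (yes _) (no _)  = refl
  𝟙-× (no _)  _       = refl

  𝟙-mono : (da : Dec A) (db : Dec B) → (A → B) → 𝟙 da ≤ 𝟙 db
  𝟙-mono (yes x) db A→B = ℕ.≤-reflexive (sym (𝟙-yes db (A→B x)))
  𝟙-mono (no _)  db A→B = z≤n

  𝟙*𝟙≤𝟙*𝟙+𝟙+𝟙 : (da : Dec A) (db : Dec B) (da′ : Dec A′) (db′ : Dec B′) (dc : Dec C) (dc′ : Dec C′) →
    (A′ → ¬ A → C) → (B′ → ¬ B → C′) → 𝟙 da′ * 𝟙 db′ ≤ 𝟙 da * 𝟙 db + 𝟙 dc + 𝟙 dc′
  𝟙*𝟙≤𝟙*𝟙+𝟙+𝟙 _       _       (no _)   _        _  _   _ _ = z≤n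
  𝟙*𝟙≤𝟙*𝟙+𝟙+𝟙 _       _       (yes _)  (no _)   _  _   _ _ = z≤n
  𝟙*𝟙≤𝟙*𝟙+𝟙+𝟙 (yes _) (yes _) (yes _)  (yes _)  dc dc′ _ _ = ℕ.≤-trans (ℕ.m≤m+n 1 (𝟙 dc)) (ℕ.m≤m+n _ (𝟙 dc′))
  𝟙*𝟙≤𝟙*𝟙+𝟙+𝟙 (no ¬x) _       (yes x′) (yes _)  dc dc′ c _ rewrite 𝟙-yes dc (c x′ ¬x) = s≤s z≤n
  𝟙*𝟙≤𝟙*𝟙+𝟙+𝟙 (yes _) (no ¬y) (yes _)  (yes y′) dc dc′ _ c′ rewrite 𝟙-yes dc′ (c′ y′ ¬y) = ℕ.m≤n+m 1 _

  𝟙-⊎ : (da : Dec A) (db : Dec B) → ¬ (A × B) → 𝟙 (da ⊎-dec db) ≡ 𝟙 da + 𝟙 db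
  𝟙-⊎ (yes x) (yes y) ¬xy = contradiction (x , y) ¬xy
  𝟙-⊎ (yes _) (no _)  _   = refl
  𝟙-⊎ (no _)  (yes _) _   = refl
  𝟙-⊎ (no _)  (no _)  _   = refl

  𝟙[×<suc] : (d : Dec A) → ∀ e c → 𝟙 (d ×-dec (e <? suc c)) ≡ 𝟙 (d ×-dec (e <? c)) + 𝟙 (d ×-dec (e ≟ c))
  𝟙[×<suc] d e c = begin
    𝟙 (d ×-dec (e <? suc c))                                  ≡⟨ 𝟙-cong (d ×-dec (e <? suc c)) ((d ×-dec (e <? c)) ⊎-dec (d ×-dec (e ≟ c))) (mk⇔
                                                                   (λ (x , e<1+c) → Sum.map (x ,_) (x ,_) (ℕ.m<1+n⇒m<n∨m≡n e<1+c))
                                                                   [ (λ (x , e<c) → x , ℕ.m<n⇒m<1+n e<c) , (λ { (x , refl) → x , ℕ.n<1+n e }) ]) ⟩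
    𝟙 ((d ×-dec (e <? c)) ⊎-dec (d ×-dec (e ≟ c)))           ≡⟨ 𝟙-⊎ (d ×-dec (e <? c)) (d ×-dec (e ≟ c)) (λ ((_ , e<c) , (_ , e≡c)) → ℕ.<-irrefl e≡c e<c) ⟩
    𝟙 (d ×-dec (e <? c)) + 𝟙 (d ×-dec (e ≟ c))               ∎
    where open ≡-Reasoning

  sumBelowℕ-𝟙[×≡] : (d : Dec A) → ∀ e c → sumBelowℕ c (λ b → 𝟙 (d ×-dec (e ≟ b))) ≡ 𝟙 (d ×-dec (e <? c))
  sumBelowℕ-𝟙[×≡] d e zero    = sym (𝟙-no (d ×-dec (e <? 0)) (λ ()))
  sumBelowℕ-𝟙[×≡] d e (suc c) = trans (cong (_+ 𝟙 (d ×-dec (e ≟ c))) (sumBelowℕ-𝟙[×≡] d e c)) (sym (𝟙[×<suc] d e c))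

module Congruences where

  open import Defs using (fromℕ; mod; div; δ)
  open Indicators using (𝟙; 𝟙-cong)
  open import Data.Nat as ℕ using (ℕ; zero; suc; _+_; _*_; _∸_; _≤_; _<_; NonZero; _≟_; _≤?_)
  open import Data.Nat.Properties
  open import Data.Nat.DivMod
  open import Data.Nat.Divisibility
  open import Data.Nat.Coprimality using (Coprime; coprime⇒gcd≡1)
  open import Data.Nat.LCM using (lcm; lcm-least; gcd*lcm)
  open import Data.Integer as ℤ using (+_)
  import Data.Integer.Properties as ℤ
  open import Data.Product using (_×_; _,_)
  open import Function.Bundles using (_⇔_; mk⇔)
  open import Relation.Nullary using (yes; no; contradiction)
  open import Relation.Binary.PropositionalEquality

  mod≡% : ∀ a m .{{_ : NonZero m}} → mod a m ≡ a % m
  mod≡% a (suc m) = refl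

  div≡/ : ∀ a m .{{_ : NonZero m}} → div a m ≡ a / m
  div≡/ a (suc m) = refl

  +-*-unique : ∀ m .{{_ : NonZero m}} {a b c d} → b < m → d < m → b + a * m ≡ d + c * m → b ≡ d × a ≡ c
  +-*-unique m {a} {b} {c} {d} b<m d<m eq =
    b≡d , *-cancelʳ-≡ a c m (+-cancelˡ-≡ d _ _ (subst (λ z → z + a * m ≡ d + c * m) b≡d eq))
    where
    open ≡-Reasoning
    b≡d : b ≡ d
    b≡d = begin
      b                ≡⟨ sym (m<n⇒m%n≡m b<m) ⟩
      b % m            ≡⟨ sym ([m+kn]%n≡m%n b a m) ⟩
      (b + a * m) % m  ≡⟨ cong (_% m) eq ⟩
      (d + c * m) % m  ≡⟨ [m+kn]%n≡m%n d c m ⟩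
      d % m            ≡⟨ m<n⇒m%n≡m d<m ⟩
      d                ∎

  ∣∧<⇒≡0 : ∀ {m t} → m ∣ t → t < m → t ≡ 0
  ∣∧<⇒≡0 (divides zero    refl) _   = refl
  ∣∧<⇒≡0 {m} (divides (suc q) refl) t<m = contradiction (m≤m+n m (q * m)) (<⇒≱ t<m)

  %≡%⇒∣∸ : ∀ m .{{_ : NonZero m}} {a b} → a % m ≡ b % m → m ∣ b ∸ a
  %≡%⇒∣∸ m {a} {b} a≡b = divides (b / m ∸ a / m) (begin
    b ∸ a                                         ≡⟨ cong₂ _∸_ (m≡m%n+[m/n]*n b m) (m≡m%n+[m/n]*n a m) ⟩
    (b % m + b / m * m) ∸ (a % m + a / m * m)     ≡⟨ cong (λ z → (b % m + b / m * m) ∸ (z + a / m * m)) a≡b ⟩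
    (b % m + b / m * m) ∸ (b % m + a / m * m)     ≡⟨ [m+n]∸[m+o]≡n∸o (b % m) _ _ ⟩
    b / m * m ∸ a / m * m                         ≡⟨ sym (*-distribʳ-∸ m (b / m) (a / m)) ⟩
    (b / m ∸ a / m) * m                           ∎)
    where open ≡-Reasoning

  ∣∸⇒%≡% : ∀ m .{{_ : NonZero m}} {a b} → a ≤ b → m ∣ b ∸ a → a % m ≡ b % m
  ∣∸⇒%≡% m {a} {b} a≤b (divides q b∸a≡qm) = begin
    a % m                  ≡⟨ sym ([m+kn]%n≡m%n a q m) ⟩
    (a + q * m) % m        ≡⟨ cong (λ z → (a + z) % m) (sym b∸a≡qm) ⟩
    (a + (b ∸ a)) % m      ≡⟨ cong (_% m) (m+[n∸m]≡n a≤b) ⟩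
    b % m                  ∎
    where open ≡-Reasoning

  %≡%⇔∣∣-∣ : ∀ m .{{_ : NonZero m}} k x → k % m ≡ x % m ⇔ m ∣ ℤ.∣ + k ℤ.- + x ∣
  %≡%⇔∣∣-∣ m k x with x ≤? k
  ... | yes x≤k rewrite ℤ.m-n≡m⊖n k x | ℤ.⊖-≥ x≤k =
    mk⇔ (λ k≡x → %≡%⇒∣∸ m (sym k≡x)) (λ m∣k∸x → sym (∣∸⇒%≡% m x≤k m∣k∸x))
  ... | no x≰k rewrite ℤ.m-n≡m⊖n k x | ℤ.∣⊖∣-≰ x≰k =
    mk⇔ (%≡%⇒∣∸ m) (∣∸⇒%≡% m (<⇒≤ (≰⇒> x≰k)))

  δ≡𝟙[%≡%] : ∀ m .{{_ : NonZero m}} k x → δ m (+ k ℤ.- + x) ≡ fromℕ (𝟙 (k % m ≟ x % m))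
  δ≡𝟙[%≡%] m k x with m ∣? ℤ.∣ + k ℤ.- + x ∣ | %≡%⇔∣∣-∣ m k x
  ... | yes m∣ | k≡x⇔m∣ = sym (cong fromℕ (𝟙-cong (k % m ≟ x % m) (yes m∣) k≡x⇔m∣))
  ... | no m∤  | k≡x⇔m∣ = sym (cong fromℕ (𝟙-cong (k % m ≟ x % m) (no m∤) k≡x⇔m∣))

  %-inverse⇒coprime : ∀ m n n′ .{{_ : NonZero m}} → (n * n′) % m ≡ 1 → Coprime m n
  %-inverse⇒coprime m n n′ nn′≡1 {d} (d∣m , d∣n) = ∣1⇒≡1 (∣m+n∣m⇒∣n d∣q*m+1 (∣-trans d∣m (n∣m*n q)))
    where
    q : ℕ
    q = (n * n′) / m
    d∣q*m+1 : d ∣ q * m + 1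
    d∣q*m+1 = subst (d ∣_) (trans (m≡m%n+[m/n]*n (n * n′) m) (trans (cong (_+ q * m) nn′≡1) (+-comm 1 (q * m))))
                           (∣-trans d∣n (m∣m*n n′))

  coprime⇒*∣ : ∀ {m n t} → Coprime m n → m ∣ t → n ∣ t → m * n ∣ t
  coprime⇒*∣ {m} {n} coprime m∣t n∣t = subst (_∣ _) lcm≡m*n (lcm-least m∣t n∣t)
    where
    lcm≡m*n : lcm m n ≡ m * n
    lcm≡m*n = trans (sym (*-identityˡ (lcm m n)))
                    (trans (cong (_* lcm m n) (sym (coprime⇒gcd≡1 coprime))) (gcd*lcm m n))

  %≡%-combine : ∀ m n .{{_ : NonZero m}} .{{_ : NonZero n}} .{{_ : NonZero (m * n)}} → Coprime m n → ∀ a b →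
    a % m ≡ b % m → a % n ≡ b % n → a % (m * n) ≡ b % (m * n)
  %≡%-combine m n coprime a b a≡b[m] a≡b[n] with a ≤? b
  ... | yes a≤b = ∣∸⇒%≡% (m * n) a≤b (coprime⇒*∣ coprime (%≡%⇒∣∸ m a≡b[m]) (%≡%⇒∣∸ n a≡b[n]))
  ... | no a≰b  = sym (∣∸⇒%≡% (m * n) (<⇒≤ (≰⇒> a≰b))
                         (coprime⇒*∣ coprime (%≡%⇒∣∸ m (sym a≡b[m])) (%≡%⇒∣∸ n (sym a≡b[n]))))

  %-inverse-* : ∀ m u a .{{_ : NonZero m}} → u % m ≡ 1 → a < m → (u * a) % m ≡ a
  %-inverse-* m u a u≡1 a<m = begin
    (u * a) % m               ≡⟨ %-distribˡ-* u a m ⟩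
    ((u % m) * (a % m)) % m   ≡⟨ cong (λ z → (z * (a % m)) % m) u≡1 ⟩
    (1 * (a % m)) % m         ≡⟨ cong (_% m) (*-identityˡ (a % m)) ⟩
    a % m % m                 ≡⟨ m%n%n≡m%n a m ⟩
    a % m                     ≡⟨ m<n⇒m%n≡m a<m ⟩
    a                         ∎
    where open ≡-Reasoning

  -- The Chinese remainder theorem with given inverses M₁ of m₂ modulo m₁ and M₂ of
  -- m₁ modulo m₂; these inverses already force m₁ and m₂ to be coprime.
  module CRT (m₁ m₂ : ℕ) .{{_ : NonZero m₁}} .{{_ : NonZero m₂}} (M₁ M₂ a₁ a₂ : ℕ)
             (M₁-inv : (m₂ * M₁) % m₁ ≡ 1) (M₂-inv : (m₁ * M₂) % m₂ ≡ 1) (a₁<m₁ : a₁ < m₁) (a₂<m₂ : a₂ < m₂) where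

    private instance
      m₁m₂≢0 : NonZero (m₁ * m₂)
      m₁m₂≢0 = m*n≢0 m₁ m₂

    solution : ℕ
    solution = M₁ * m₂ * a₁ + M₂ * m₁ * a₂

    private
      rearrange : ∀ a b c → a * b * c ≡ a * c * b
      rearrange a b c = trans (*-assoc a b c) (trans (cong (a *_) (*-comm b c)) (sym (*-assoc a c b)))

      solution≡a₁ : solution % m₁ ≡ a₁
      solution≡a₁ = begin
        (M₁ * m₂ * a₁ + M₂ * m₁ * a₂) % m₁  ≡⟨ cong (λ z → (M₁ * m₂ * a₁ + z) % m₁) (rearrange M₂ m₁ a₂) ⟩
        (M₁ * m₂ * a₁ + M₂ * a₂ * m₁) % m₁  ≡⟨ [m+kn]%n≡m%n (M₁ * m₂ * a₁) (M₂ * a₂) m₁ ⟩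
        (M₁ * m₂ * a₁) % m₁                 ≡⟨ cong (λ z → (z * a₁) % m₁) (*-comm M₁ m₂) ⟩
        (m₂ * M₁ * a₁) % m₁                 ≡⟨ %-inverse-* m₁ (m₂ * M₁) a₁ M₁-inv a₁<m₁ ⟩
        a₁                                  ∎
        where open ≡-Reasoning

      solution≡a₂ : solution % m₂ ≡ a₂
      solution≡a₂ = begin
        (M₁ * m₂ * a₁ + M₂ * m₁ * a₂) % m₂  ≡⟨ cong (_% m₂) (+-comm (M₁ * m₂ * a₁) (M₂ * m₁ * a₂)) ⟩
        (M₂ * m₁ * a₂ + M₁ * m₂ * a₁) % m₂  ≡⟨ cong (λ z → (M₂ * m₁ * a₂ + z) % m₂) (rearrange M₁ m₂ a₁) ⟩
        (M₂ * m₁ * a₂ + M₁ * a₁ * m₂) % m₂  ≡⟨ [m+kn]%n≡m%n (M₂ * m₁ * a₂) (M₁ * a₁) m₂ ⟩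
        (M₂ * m₁ * a₂) % m₂                 ≡⟨ cong (λ z → (z * a₂) % m₂) (*-comm M₂ m₁) ⟩
        (m₁ * M₂ * a₂) % m₂                 ≡⟨ %-inverse-* m₂ (m₁ * M₂) a₂ M₂-inv a₂<m₂ ⟩
        a₂                                  ∎
        where open ≡-Reasoning

      reduce₁ : ∀ k → k % (m₁ * m₂) % m₁ ≡ k % m₁
      reduce₁ k = m∣n⇒o%n%m≡o%m m₁ (m₁ * m₂) k (m∣m*n m₂)

      reduce₂ : ∀ k → k % (m₁ * m₂) % m₂ ≡ k % m₂
      reduce₂ k = m∣n⇒o%n%m≡o%m m₂ (m₁ * m₂) k (n∣m*n m₁)

    crt : ∀ k → k % (m₁ * m₂) ≡ solution % (m₁ * m₂) ⇔ (k % m₁ ≡ a₁ × k % m₂ ≡ a₂)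
    crt k = mk⇔
      (λ k≡s → trans (sym (reduce₁ k)) (trans (cong (_% m₁) k≡s) (trans (reduce₁ solution) solution≡a₁))
             , trans (sym (reduce₂ k)) (trans (cong (_% m₂) k≡s) (trans (reduce₂ solution) solution≡a₂)))
      (λ (k≡a₁ , k≡a₂) → %≡%-combine m₁ m₂ (%-inverse⇒coprime m₁ m₂ M₁ M₁-inv) k solution
                           (trans k≡a₁ (sym solution≡a₁)) (trans k≡a₂ (sym solution≡a₂)))

open import Defs using (mod)
open import Data.Nat using (ℕ; NonZero; _<_; _≤_; _*_; _^_)
open import Data.Product using (_×_)
open import Relation.Binary.PropositionalEquality using (_≡_)

module ResidueCount (m : ℕ) .{{_ : NonZero m}} (c : ℕ) (c<m : c < m) where

  open import Defs using (fromℕ; inv)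
  open Rationals
  open FiniteSums using (sumBelowℕ)
  open Indicators using (𝟙)
  open Congruences using (%≡%⇒∣∸; ∣∧<⇒≡0)
  open import Data.Nat using (zero; suc; >-nonZero⁻¹; _+_; _*_; _∸_; _≤_; z≤n; _≟_; _≤?_)
  open import Data.Nat.Properties
  open import Data.Nat.DivMod
  open import Data.Nat.Divisibility using (_∣_)
  open import Data.Nat.Solver using (module +-*-Solver)
  open import Data.Rational as ℚ using (ℚ; 1ℚ)
  import Data.Rational.Properties as ℚ
  open import Data.Rational.Solver as ℚSolver using ()
  open import Relation.Nullary using (Dec; yes; no; contradiction)
  open import Relation.Binary.PropositionalEquality

  -- The distance from k to the next integer ≡ c (mod m).
  gap : ℕ → ℕ
  gap k = (c + m ∸ k % m) % m

  gap<m : ∀ k → gap k < m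
  gap<m k = m%n<n _ m

  gap-spec : ∀ k → (k + gap k) % m ≡ c
  gap-spec k = begin
    (k + X % m) % m              ≡⟨ %-distribˡ-+ k (X % m) m ⟩
    (k % m + X % m % m) % m      ≡⟨ cong (λ z → (k % m + z) % m) (m%n%n≡m%n X m) ⟩
    (k % m + X % m) % m          ≡⟨ cong (λ z → (z + X % m) % m) (sym (m%n%n≡m%n k m)) ⟩
    (k % m % m + X % m) % m      ≡⟨ sym (%-distribˡ-+ (k % m) X m) ⟩
    (k % m + X) % m              ≡⟨ cong (_% m) (m+[n∸m]≡n (≤-trans (m%n≤n k m) (m≤n+m m c))) ⟩
    (c + m) % m                  ≡⟨ [m+n]%n≡m%n c m ⟩
    c % m                        ≡⟨ m<n⇒m%n≡m c<m ⟩
    c                            ∎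
    where
    open ≡-Reasoning
    X : ℕ
    X = c + m ∸ k % m

  +-%-injectiveʳ : ∀ k {u v} → u < m → v < m → (k + u) % m ≡ (k + v) % m → u ≡ v
  +-%-injectiveʳ k {u} {v} u<m v<m k+u≡k+v with u ≤? v
  ... | yes u≤v = ≤-antisym u≤v (m∸n≡0⇒m≤n (∣∧<⇒≡0
                    (subst (m ∣_) ([m+n]∸[m+o]≡n∸o k v u) (%≡%⇒∣∸ m k+u≡k+v)) (≤-<-trans (m∸n≤m v u) v<m)))
  ... | no u≰v  = ≤-antisym (m∸n≡0⇒m≤n (∣∧<⇒≡0
                    (subst (m ∣_) ([m+n]∸[m+o]≡n∸o k u v) (%≡%⇒∣∸ m (sym k+u≡k+v))) (≤-<-trans (m∸n≤m u v) u<m)))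
                    (<⇒≤ (≰⇒> u≰v))

  gap-unique : ∀ k {v} → v < m → (k + v) % m ≡ c → v ≡ gap k
  gap-unique k v<m k+v≡c = +-%-injectiveʳ k v<m (gap<m k) (trans k+v≡c (sym (gap-spec k)))

  hit? : ∀ k → Dec (k % m ≡ c)
  hit? k = k % m ≟ c

  private
    1+[m∸1]≡m : suc (m ∸ 1) ≡ m
    1+[m∸1]≡m = m+[n∸m]≡n (>-nonZero⁻¹ m)

  -- Passing a hit resets the gap from 0 to m - 1; otherwise the gap just decreases.
  gap-step : ∀ k → 𝟙 (hit? k) * m + gap k ≡ 1 + gap (suc k)
  gap-step k with hit? k
  ... | yes k≡c = begin
    1 * m + gap k       ≡⟨ cong (1 * m +_) (sym (gap-unique k (>-nonZero⁻¹ m) (trans (cong (_% m) (+-identityʳ k)) k≡c))) ⟩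
    1 * m + 0           ≡⟨ trans (+-identityʳ (1 * m)) (*-identityˡ m) ⟩
    m                   ≡⟨ sym 1+[m∸1]≡m ⟩
    1 + (m ∸ 1)         ≡⟨ cong suc (gap-unique (suc k) (≤-reflexive 1+[m∸1]≡m) next-hit) ⟩
    1 + gap (suc k)     ∎
    where
    open ≡-Reasoning
    next-hit : (suc k + (m ∸ 1)) % m ≡ c
    next-hit = trans (cong (_% m) (trans (sym (+-suc k (m ∸ 1))) (cong (k +_) 1+[m∸1]≡m)))
                     (trans ([m+n]%n≡m%n k m) k≡c)
  ... | no k≢c with gap k in gap≡ | gap-spec k
  ...   | zero  | k+0≡c = contradiction (trans (sym (cong (_% m) (+-identityʳ k))) k+0≡c) k≢c
  ...   | suc v | k+1+v≡c = cong suc (gap-unique (suc k) (≤-trans (n≤1+n (suc v)) (subst (_< m) gap≡ (gap<m k)))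
                                       (trans (cong (_% m) (sym (+-suc k v))) k+1+v≡c))

  hits : ℕ → ℕ → ℕ
  hits Q N = sumBelowℕ N (λ i → 𝟙 (hit? (Q + i)))

  hits-invariant : ∀ Q N → hits Q N * m + gap Q ≡ N + gap (Q + N)
  hits-invariant Q zero    = cong gap (sym (+-identityʳ Q))
  hits-invariant Q (suc N) = begin
    (hits Q N + h) * m + gap Q          ≡⟨ solve 4 (λ a b m x → (a :+ b) :* m :+ x := (a :* m :+ x) :+ b :* m) refl (hits Q N) h m (gap Q) ⟩
    (hits Q N * m + gap Q) + h * m      ≡⟨ cong (_+ h * m) (hits-invariant Q N) ⟩
    (N + gap (Q + N)) + h * m           ≡⟨ solve 3 (λ a b c → (a :+ b) :+ c := a :+ (c :+ b)) refl N (gap (Q + N)) (h * m) ⟩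
    N + (h * m + gap (Q + N))           ≡⟨ cong (N +_) (gap-step (Q + N)) ⟩
    N + (1 + gap (suc (Q + N)))         ≡⟨ +-suc N (gap (suc (Q + N))) ⟩
    suc N + gap (suc (Q + N))           ≡⟨ cong (λ z → suc N + gap z) (sym (+-suc Q N)) ⟩
    suc N + gap (Q + suc N)             ∎
    where
    open ≡-Reasoning
    open +-*-Solver
    h : ℕ
    h = 𝟙 (hit? (Q + N))

  hits≤1 : ∀ Q N → N ≤ m → hits Q N ≤ 1
  hits≤1 Q N N≤m with hits Q N in hits≡ | hits-invariant Q N
  ... | zero          | _   = z≤n
  ... | suc zero      | _   = ≤-refl
  ... | suc (suc t)   | inv = contradiction (≤-trans m+m≤ (≤-reflexive inv)) (<⇒≱ (+-mono-≤-< N≤m (gap<m (Q + N))))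
    where
    m+m≤ : m + m ≤ suc (suc t) * m + gap Q
    m+m≤ = ≤-trans (+-monoʳ-≤ m (m≤m+n m (t * m))) (m≤m+n _ (gap Q))

  ∣hits-N/m∣≤1 : ∀ Q N → ℚ.∣ fromℕ (hits Q N) ℚ.- fromℕ N ℚ.* inv m ∣ ℚ.≤ 1ℚ
  ∣hits-N/m∣≤1 Q N = subst (λ z → ℚ.∣ z ∣ ℚ.≤ 1ℚ) (sym hits-N/m≡)
    (∣p-q∣≤r (fromℕ*inv-nonNeg (gap (Q + N)) m) (fromℕ*inv≤1 m (<⇒≤ (gap<m (Q + N))))
             (fromℕ*inv-nonNeg (gap Q) m)       (fromℕ*inv≤1 m (<⇒≤ (gap<m Q))))
    where
    open ℚSolver.+-*-Solver
    open ≡-Reasoning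
    h n g₀ g₁ : ℚ
    h = fromℕ (hits Q N)
    n = fromℕ N
    g₀ = fromℕ (gap Q)
    g₁ = fromℕ (gap (Q + N))
    invariantℚ : h ℚ.* fromℕ m ℚ.+ g₀ ≡ n ℚ.+ g₁
    invariantℚ = begin
      h ℚ.* fromℕ m ℚ.+ g₀            ≡⟨ cong (ℚ._+ g₀) (sym (fromℕ-* (hits Q N) m)) ⟩
      fromℕ (hits Q N * m) ℚ.+ g₀     ≡⟨ sym (fromℕ-+ (hits Q N * m) (gap Q)) ⟩
      fromℕ (hits Q N * m + gap Q)    ≡⟨ cong fromℕ (hits-invariant Q N) ⟩
      fromℕ (N + gap (Q + N))         ≡⟨ fromℕ-+ N (gap (Q + N)) ⟩
      n ℚ.+ g₁                        ∎
    hits-N/m≡ : h ℚ.- n ℚ.* inv m ≡ g₁ ℚ.* inv m ℚ.- g₀ ℚ.* inv m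
    hits-N/m≡ = begin
      h ℚ.- n ℚ.* inv m                                       ≡⟨ cong (λ z → z ℚ.- n ℚ.* inv m) (sym (trans (cong (h ℚ.*_) (inv-inverseʳ m)) (ℚ.*-identityʳ h))) ⟩
      h ℚ.* (fromℕ m ℚ.* inv m) ℚ.- n ℚ.* inv m               ≡⟨ solve 5 (λ h M i g n → h :* (M :* i) :- n :* i := ((h :* M :+ g) :- g) :* i :- n :* i) refl h (fromℕ m) (inv m) g₀ n ⟩
      ((h ℚ.* fromℕ m ℚ.+ g₀) ℚ.- g₀) ℚ.* inv m ℚ.- n ℚ.* inv m ≡⟨ cong (λ z → (z ℚ.- g₀) ℚ.* inv m ℚ.- n ℚ.* inv m) invariantℚ ⟩
      ((n ℚ.+ g₁) ℚ.- g₀) ℚ.* inv m ℚ.- n ℚ.* inv m           ≡⟨ solve 4 (λ n g₁ g₀ i → ((n :+ g₁) :- g₀) :* i :- n :* i := g₁ :* i :- g₀ :* i) refl n g₁ g₀ (inv m) ⟩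
      g₁ ℚ.* inv m ℚ.- g₀ ℚ.* inv m                           ∎

module BaseExpansion (p : ℕ) (1<p : 1 < p) where

  open import Defs using (fromℕ; inv; mod; div; digit; φ; trunc; sumBelow; Σℕ[_⋯_])
  open Rationals
  open FiniteSums
  open Indicators
  open Congruences using (mod≡%; div≡/; +-*-unique)
  open import Data.Nat using (zero; suc; s≤s⁻¹; >-nonZero; _+_; _*_; _∸_; _^_; _≤_; NonZero; z≤n; s≤s; _≟_; _<?_; _≤?_)
  open import Data.Nat.Properties
  open import Data.Nat.DivMod
  open import Data.Nat.Solver using (module +-*-Solver)
  open import Data.Rational as ℚ using (ℚ; 0ℚ; 1ℚ; nonNegative)
  import Data.Rational.Properties as ℚ
  import Data.Rational.Solver as ℚSolver
  open import Data.Product using (_×_; _,_)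
  open import Data.Sum using (inj₁; inj₂)
  open import Function.Bundles using (_⇔_; mk⇔; Equivalence)
  open import Relation.Nullary using (Dec; yes; no; ¬_; contradiction)
  open import Relation.Nullary.Decidable using (_×-dec_; map′)
  open import Relation.Binary.Definitions using (tri<; tri≈; tri>)
  open import Relation.Binary.PropositionalEquality

  private instance
    p≢0 : NonZero p
    p≢0 = >-nonZero (<-trans (s≤s z≤n) 1<p)

  p^≢0 : ∀ s → NonZero (p ^ s)
  p^≢0 s = m^n≢0 p s

  IsDigits : (ℕ → ℕ) → Set
  IsDigits y = ∀ j → 1 ≤ j → y j < p

  Agree : (ℕ → ℕ) → (ℕ → ℕ) → ℕ → Set
  Agree u y s = ∀ j → 1 ≤ j → j ≤ s → u j ≡ y j

  Agree-suc : ∀ {u y s} → Agree u y s → u (suc s) ≡ y (suc s) → Agree u y (suc s)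
  Agree-suc agree u≡y j 1≤j j≤1+s with m≤n⇒m<n∨m≡n j≤1+s
  ... | inj₁ j<1+s = agree j 1≤j (s≤s⁻¹ j<1+s)
  ... | inj₂ refl  = u≡y

  Agree-mono : ∀ {u y s t} → s ≤ t → Agree u y t → Agree u y s
  Agree-mono s≤t agree j 1≤j j≤s = agree j 1≤j (≤-trans j≤s s≤t)

  agree? : ∀ u y s → Dec (Agree u y s)
  agree? u y zero    = yes (λ j 1≤j j≤0 → contradiction j≤0 (<⇒≱ 1≤j))
  agree? u y (suc s) = map′ (λ (agree , u≡y) → Agree-suc agree u≡y)
                            (λ agree → Agree-mono (n≤1+n s) agree , agree (suc s) (s≤s z≤n) ≤-refl)
                            (agree? u y s ×-dec (u (suc s) ≟ y (suc s)))

  fromDigits : (ℕ → ℕ) → ℕ → ℕ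
  fromDigits y zero    = 0
  fromDigits y (suc s) = fromDigits y s + y (suc s) * p ^ s

  -- numer y L / p^L = [y]_L.
  numer : (ℕ → ℕ) → ℕ → ℕ
  numer y zero    = 0
  numer y (suc L) = p * numer y L + y (suc L)

  belowAt : (ℕ → ℕ) → (ℕ → ℕ) → ℕ → ℕ
  belowAt u y s = 𝟙 (agree? u y s ×-dec (u (suc s) <? y (suc s)))

  private
    r+d*P<p*P : ∀ {r d P} → r < P → d < p → r + d * P < p * P
    r+d*P<p*P {r} {d} {P} r<P d<p = <-≤-trans (+-monoˡ-< (d * P) r<P) (*-monoˡ-≤ P d<p)

    p*a+u<p*[1+a] : ∀ a {u} → u < p → p * a + u < p * suc a
    p*a+u<p*[1+a] a u<p = <-≤-trans (+-monoʳ-< (p * a) u<p) (≤-reflexive (trans (+-comm (p * a) p) (sym (*-suc p a))))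

    p*a+u<p*b+v : ∀ {a b u v} → a < b → u < p → p * a + u < p * b + v
    p*a+u<p*b+v {a} {b} {v = v} a<b u<p = <-≤-trans (p*a+u<p*[1+a] a u<p) (≤-trans (*-monoʳ-≤ p a<b) (m≤m+n (p * b) v))

  fromDigits<p^ : ∀ {y} → IsDigits y → ∀ s → fromDigits y s < p ^ s
  fromDigits<p^ digits zero    = s≤s z≤n
  fromDigits<p^ digits (suc s) = r+d*P<p*P (fromDigits<p^ digits s) (digits (suc s) (s≤s z≤n))

  fromDigits+b*p^s<p^[1+s] : ∀ {x} → IsDigits x → ∀ s {b} → b < p → fromDigits x s + b * p ^ s < p ^ suc s
  fromDigits+b*p^s<p^[1+s] digits s b<p = r+d*P<p*P (fromDigits<p^ digits s) b<p

  numer<p^ : ∀ {y} → IsDigits y → ∀ L → numer y L < p ^ L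
  numer<p^ digits zero    = s≤s z≤n
  numer<p^ {y} digits (suc L) = <-≤-trans (p*a+u<p*[1+a] (numer y L) (digits (suc L) (s≤s z≤n))) (*-monoʳ-≤ p (numer<p^ digits L))

  fromDigits-injective : ∀ {u y} → IsDigits u → IsDigits y → ∀ s → fromDigits u s ≡ fromDigits y s → Agree u y s
  fromDigits-injective du dy zero    _  = λ j 1≤j j≤0 → contradiction j≤0 (<⇒≱ 1≤j)
  fromDigits-injective {u} {y} du dy (suc s) eq
    with +-*-unique (p ^ s) {{p^≢0 s}} {u (suc s)} {fromDigits u s} {y (suc s)} {fromDigits y s} (fromDigits<p^ du s) (fromDigits<p^ dy s) eq
  ... | low≡ , u≡y = Agree-suc (fromDigits-injective du dy s low≡) u≡y

  Agree⇒fromDigits≡ : ∀ {u y} s → Agree u y s → fromDigits u s ≡ fromDigits y s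
  Agree⇒fromDigits≡ zero    agree = refl
  Agree⇒fromDigits≡ (suc s) agree = cong₂ (λ a b → a + b * p ^ s) (Agree⇒fromDigits≡ s (Agree-mono (n≤1+n s) agree)) (agree (suc s) (s≤s z≤n) ≤-refl)

  numer-injective : ∀ {u y} → IsDigits u → IsDigits y → ∀ L → numer u L ≡ numer y L → Agree u y L
  numer-injective du dy zero    _  = λ j 1≤j j≤0 → contradiction j≤0 (<⇒≱ 1≤j)
  numer-injective {u} {y} du dy (suc L) eq
    with +-*-unique p {numer u L} {u (suc L)} {numer y L} {y (suc L)} (du (suc L) (s≤s z≤n)) (dy (suc L) (s≤s z≤n))
           (trans (+-comm (u (suc L)) _) (trans (cong (_+ u (suc L)) (*-comm (numer u L) p))
             (trans eq (trans (cong (_+ y (suc L)) (*-comm p (numer y L))) (+-comm _ (y (suc L)))))))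
  ... | u≡y , high≡ = Agree-suc (numer-injective du dy L high≡) u≡y

  Agree⇒numer≡ : ∀ {u y} L → Agree u y L → numer u L ≡ numer y L
  Agree⇒numer≡ zero    agree = refl
  Agree⇒numer≡ (suc L) agree = cong₂ (λ a b → p * a + b) (Agree⇒numer≡ L (Agree-mono (n≤1+n L) agree)) (agree (suc L) (s≤s z≤n) ≤-refl)

  𝟙[p*a+u<p*b+v] : ∀ {A : Set} (d : Dec A) {a b u v} → u < p → v < p → (a ≡ b ⇔ A) →
    𝟙 (p * a + u <? p * b + v) ≡ 𝟙 (a <? b) + 𝟙 (d ×-dec (u <? v))
  𝟙[p*a+u<p*b+v] d {a} {b} {u} {v} u<p v<p a≡b⇔A with <-cmp a b
  ... | tri< a<b _ _ = trans (𝟙-yes (p * a + u <? p * b + v) (p*a+u<p*b+v a<b u<p))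
    (cong₂ _+_ (sym (𝟙-yes (a <? b) a<b)) (sym (𝟙-no (d ×-dec (u <? v)) (λ (x , _) → <-irrefl (Equivalence.from a≡b⇔A x) a<b))))
  ... | tri≈ _ refl _ = trans
    (𝟙-cong (p * a + u <? p * a + v) (d ×-dec (u <? v))
            (mk⇔ (λ lt → Equivalence.to a≡b⇔A refl , +-cancelˡ-< (p * a) u v lt) (λ (_ , u<v) → +-monoʳ-< (p * a) u<v)))
    (cong (_+ 𝟙 (d ×-dec (u <? v))) (sym (𝟙-no (a <? a) (n≮n a))))
  ... | tri> _ a≢b b<a = trans (𝟙-no (p * a + u <? p * b + v) (<-asym (p*a+u<p*b+v b<a v<p)))
    (cong₂ _+_ (sym (𝟙-no (a <? b) (<-asym b<a))) (sym (𝟙-no (d ×-dec (u <? v)) (λ (x , _) → a≢b (Equivalence.from a≡b⇔A x)))))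

  𝟙[numer<numer] : ∀ {u y} → IsDigits u → IsDigits y → ∀ L → 𝟙 (numer u L <? numer y L) ≡ sumBelowℕ L (belowAt u y)
  𝟙[numer<numer] du dy zero    = refl
  𝟙[numer<numer] {u} {y} du dy (suc L) =
    trans (𝟙[p*a+u<p*b+v] (agree? u y L) (du (suc L) (s≤s z≤n)) (dy (suc L) (s≤s z≤n))
                          (mk⇔ (numer-injective du dy L) (Agree⇒numer≡ L)))
          (cong (_+ belowAt u y L) (𝟙[numer<numer] du dy L))

  trunc≡sumBelow : ∀ y L → trunc p y L ≡ sumBelow L (λ s → fromℕ (y (suc s)) ℚ.* inv (p ^ suc s))
  trunc≡sumBelow y L = Σℚ≡sumBelow 1 L (λ j → fromℕ (y j) ℚ.* inv (p ^ j))

  trunc≡numer/p^ : ∀ y L → trunc p y L ≡ fromℕ (numer y L) ℚ.* inv (p ^ L)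
  trunc≡numer/p^ y L = trans (trunc≡sumBelow y L) (sum≡numer/p^ L)
    where
    open ℚSolver.+-*-Solver
    sum≡numer/p^ : ∀ L → sumBelow L (λ s → fromℕ (y (suc s)) ℚ.* inv (p ^ suc s)) ≡ fromℕ (numer y L) ℚ.* inv (p ^ L)
    sum≡numer/p^ zero    = sym (ℚ.*-zeroˡ (inv 1))
    sum≡numer/p^ (suc L) = begin
      S ℚ.+ y′ ℚ.* inv (p * p ^ L)                      ≡⟨ cong₂ (λ a b → a ℚ.+ y′ ℚ.* b) (sum≡numer/p^ L) (inv-* p (p ^ L) {{p≢0}} {{p^≢0 L}}) ⟩
      r ℚ.* i ℚ.+ y′ ℚ.* (inv p ℚ.* i)                  ≡⟨ cong (ℚ._+ y′ ℚ.* (inv p ℚ.* i)) (sym (trans (cong (r ℚ.* i ℚ.*_) (inv-inverseʳ p)) (ℚ.*-identityʳ (r ℚ.* i)))) ⟩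
      r ℚ.* i ℚ.* (fromℕ p ℚ.* inv p) ℚ.+ y′ ℚ.* (inv p ℚ.* i)
                                                        ≡⟨ solve 5 (λ r i P I y → r :* i :* (P :* I) :+ y :* (I :* i) := (P :* r :+ y) :* (I :* i))
                                                             refl r i (fromℕ p) (inv p) y′ ⟩
      (fromℕ p ℚ.* r ℚ.+ y′) ℚ.* (inv p ℚ.* i)          ≡⟨ cong₂ ℚ._*_ (sym (trans (fromℕ-+ (p * numer y L) (y (suc L))) (cong (ℚ._+ y′) (fromℕ-* p (numer y L)))))
                                                                        (sym (inv-* p (p ^ L) {{p≢0}} {{p^≢0 L}})) ⟩
      fromℕ (numer y (suc L)) ℚ.* inv (p ^ suc L)       ∎
      where
      open ≡-Reasoning
      S y′ r i : ℚ
      S = sumBelow L (λ s → fromℕ (y (suc s)) ℚ.* inv (p ^ suc s))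
      y′ = fromℕ (y (suc L))
      r = fromℕ (numer y L)
      i = inv (p ^ L)

  trunc-pad : ∀ y n t → (∀ s → s < t → y (suc (n + s)) ≡ 0) → trunc p y (n + t) ≡ trunc p y n
  trunc-pad y n t vanish = begin
    trunc p y (n + t)                                         ≡⟨ trunc≡sumBelow y (n + t) ⟩
    sumBelow (n + t) (λ s → fromℕ (y (suc s)) ℚ.* inv (p ^ suc s))
      ≡⟨ sumBelow-pad n t _ (λ s s<t → trans (cong (λ z → fromℕ z ℚ.* inv (p ^ suc (n + s))) (vanish s s<t)) (ℚ.*-zeroˡ (inv (p ^ suc (n + s))))) ⟩
    sumBelow n (λ s → fromℕ (y (suc s)) ℚ.* inv (p ^ suc s))  ≡⟨ sym (trunc≡sumBelow y n) ⟩
    trunc p y n                                               ∎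
    where open ≡-Reasoning

  trunc-cong : ∀ {u y} n → Agree u y n → trunc p u n ≡ trunc p y n
  trunc-cong {u} {y} n agree = begin
    trunc p u n                                               ≡⟨ trunc≡sumBelow u n ⟩
    sumBelow n (λ s → fromℕ (u (suc s)) ℚ.* inv (p ^ suc s))  ≡⟨ sumBelow-cong n (λ s s<n → cong (λ z → fromℕ z ℚ.* inv (p ^ suc s)) (agree (suc s) (s≤s z≤n) s<n)) ⟩
    sumBelow n (λ s → fromℕ (y (suc s)) ℚ.* inv (p ^ suc s))  ≡⟨ sym (trunc≡sumBelow y n) ⟩
    trunc p y n                                               ∎
    where open ≡-Reasoning

  trunc<trunc⇔numer<numer : ∀ u y L → trunc p u L ℚ.< trunc p y L ⇔ numer u L < numer y L
  trunc<trunc⇔numer<numer u y L rewrite trunc≡numer/p^ u L | trunc≡numer/p^ y L = mk⇔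
    (λ lt → fromℕ-cancel-< (ℚ.*-cancelʳ-<-nonNeg (inv (p ^ L)) {{nonNegative (inv-nonNeg (p ^ L))}} lt))
    (λ lt → ℚ.*-monoˡ-<-pos (inv (p ^ L)) {{inv-pos (p ^ L) {{p^≢0 L}}}} (fromℕ-mono-< lt))

  digit-isDigits : ∀ k → IsDigits (digit p k)
  digit-isDigits k j _ = subst (_< p) (sym (mod≡% _ p)) (m%n<n _ p)

  digit-suc : ∀ k s → digit p k (suc s) ≡ (_/_ k (p ^ s) {{p^≢0 s}}) % p
  digit-suc k s = trans (mod≡% (div k (p ^ s)) p) (cong (_% p) (div≡/ k (p ^ s) {{p^≢0 s}}))

  n<p^n : ∀ n → n < p ^ n
  n<p^n zero    = s≤s z≤n
  n<p^n (suc n) = begin-strict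
    suc n                 ≡⟨ +-comm 1 n ⟩
    n + 1                 <⟨ +-monoˡ-< 1 (n<p^n n) ⟩
    p ^ n + 1             ≤⟨ +-monoʳ-≤ (p ^ n) (m^n>0 p n) ⟩
    p ^ n + p ^ n         ≡⟨ cong (p ^ n +_) (sym (+-identityʳ (p ^ n))) ⟩
    2 * p ^ n             ≤⟨ *-monoˡ-≤ (p ^ n) 1<p ⟩
    p * p ^ n             ∎
    where open ≤-Reasoning

  digit-vanish : ∀ k t → digit p k (suc (k + t)) ≡ 0
  digit-vanish k t = trans (digit-suc k (k + t)) (trans (cong (_% p) (m<n⇒m/n≡0 {{p^≢0 (k + t)}} k<p^[k+t])) (m<n⇒m%n≡m (<-trans (s≤s z≤n) 1<p)))
    where
    k<p^[k+t] : k < p ^ (k + t)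
    k<p^[k+t] = <-≤-trans (n<p^n k) (^-monoʳ-≤ p (m≤m+n k t))

  -- By definition φ p k = trunc p (digit p k) k, and the digits beyond k vanish.
  φ≡trunc-digit : ∀ k n → φ p k ≡ trunc p (digit p k) (n + k)
  φ≡trunc-digit k n = trans (sym (trunc-pad (digit p k) k n (λ s _ → digit-vanish k s))) (cong (trunc p (digit p k)) (+-comm k n))

  cut : ℕ → (ℕ → ℕ) → ℕ → ℕ
  cut n x j with j ≤? n
  ... | yes _ = x j
  ... | no  _ = 0

  cut-≤ : ∀ {n x j} → j ≤ n → cut n x j ≡ x j
  cut-≤ {n} {x} {j} j≤n with j ≤? n
  ... | yes _   = refl
  ... | no  j≰n = contradiction j≤n j≰n

  cut-> : ∀ {n x j} → ¬ j ≤ n → cut n x j ≡ 0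
  cut-> {n} {x} {j} j≰n with j ≤? n
  ... | yes j≤n = contradiction j≤n j≰n
  ... | no  _   = refl

  cut-isDigits : ∀ {x} n → IsDigits x → IsDigits (cut n x)
  cut-isDigits {x} n digits j 1≤j with j ≤? n
  ... | yes _ = digits j 1≤j
  ... | no  _ = <-trans (s≤s z≤n) 1<p

  private
    1+n+s≰n : ∀ n s → ¬ suc (n + s) ≤ n
    1+n+s≰n n s le = <-irrefl refl (<-≤-trans le (m≤m+n n s))

  trunc≡trunc-cut : ∀ x n k → trunc p x n ≡ trunc p (cut n x) (n + k)
  trunc≡trunc-cut x n k = trans (trunc-cong n (λ j _ j≤n → sym (cut-≤ j≤n)))
                                (sym (trunc-pad (cut n x) n k (λ s _ → cut-> (1+n+s≰n n s))))

  belowAt-cut : ∀ u x n s → s < n → belowAt u (cut n x) s ≡ belowAt u x s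
  belowAt-cut u x n s s<n = 𝟙-cong (agree? u (cut n x) s ×-dec (u (suc s) <? cut n x (suc s))) (agree? u x s ×-dec (u (suc s) <? x (suc s)))
    (mk⇔ (λ (agree , lt) → (λ j 1≤j j≤s → trans (agree j 1≤j j≤s) (cut-≤ (≤-trans j≤s (<⇒≤ s<n)))) , subst (u (suc s) <_) (cut-≤ s<n) lt)
         (λ (agree , lt) → (λ j 1≤j j≤s → trans (agree j 1≤j j≤s) (sym (cut-≤ (≤-trans j≤s (<⇒≤ s<n))))) , subst (u (suc s) <_) (sym (cut-≤ s<n)) lt))

  belowAt-cut-beyond : ∀ u x n s → belowAt u (cut n x) (n + s) ≡ 0
  belowAt-cut-beyond u x n s = 𝟙-no (agree? u (cut n x) (n + s) ×-dec (u (suc (n + s)) <? cut n x (suc (n + s))))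
    (λ (_ , lt) → n≮0 (subst (u (suc (n + s)) <_) (cut-> (1+n+s≰n n s)) lt))

  𝟙[φ<trunc] : ∀ {x} → IsDigits x → ∀ k n → 𝟙 (φ p k ℚ.<? trunc p x n) ≡ sumBelowℕ n (belowAt (digit p k) x)
  𝟙[φ<trunc] {x} digits k n = begin
    𝟙 (φ p k ℚ.<? trunc p x n)                      ≡⟨ 𝟙-cong (φ p k ℚ.<? trunc p x n) (numer e (n + k) <? numer (cut n x) (n + k))
                                                         (subst₂ (λ a b → a ℚ.< b ⇔ numer e (n + k) < numer (cut n x) (n + k))
                                                                 (sym (φ≡trunc-digit k n)) (sym (trunc≡trunc-cut x n k))
                                                                 (trunc<trunc⇔numer<numer e (cut n x) (n + k))) ⟩
    𝟙 (numer e (n + k) <? numer (cut n x) (n + k))  ≡⟨ 𝟙[numer<numer] (digit-isDigits k) (cut-isDigits n digits) (n + k) ⟩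
    sumBelowℕ (n + k) (belowAt e (cut n x))         ≡⟨ sumBelowℕ-pad n k _ (λ s _ → belowAt-cut-beyond e x n s) ⟩
    sumBelowℕ n (belowAt e (cut n x))               ≡⟨ sumBelowℕ-cong n (belowAt-cut e x n) ⟩
    sumBelowℕ n (belowAt e x)                       ∎
    where
    open ≡-Reasoning
    e : ℕ → ℕ
    e = digit p k

  k%p^s≡fromDigits : ∀ k s → mod k (p ^ s) ≡ fromDigits (digit p k) s
  k%p^s≡fromDigits k zero    = n%1≡0 k
  k%p^s≡fromDigits k (suc s) = begin
    mod k (p * P)                                ≡⟨ mod≡% k (p * P) {{pP≢0}} ⟩
    _%_ k (p * P) {{pP≢0}}                       ≡⟨ cong (λ z → _%_ z (p * P) {{pP≢0}}) k≡ ⟩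
    _%_ (r + d * P + q′ * (p * P)) (p * P) {{pP≢0}}  ≡⟨ [m+kn]%n≡m%n (r + d * P) q′ (p * P) {{pP≢0}} ⟩
    _%_ (r + d * P) (p * P) {{pP≢0}}             ≡⟨ m<n⇒m%n≡m {{pP≢0}} (r+d*P<p*P (m%n<n k P) (m%n<n q p)) ⟩
    r + d * P                                    ≡⟨ cong₂ (λ a b → a + b * P) (trans (sym (mod≡% k P)) (k%p^s≡fromDigits k s)) (sym (digit-suc k s)) ⟩
    fromDigits (digit p k) s + digit p k (suc s) * P ∎
    where
    open ≡-Reasoning
    open +-*-Solver
    P : ℕ
    P = p ^ s
    instance
      P≢0 : NonZero P
      P≢0 = p^≢0 s
    pP≢0 : NonZero (p * P)
    pP≢0 = p^≢0 (suc s)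
    r q d q′ : ℕ
    r = k % P
    q = k / P
    d = q % p
    q′ = q / p
    k≡ : k ≡ r + d * P + q′ * (p * P)
    k≡ = begin
      k                          ≡⟨ m≡m%n+[m/n]*n k P ⟩
      r + q * P                  ≡⟨ cong (λ z → r + z * P) (m≡m%n+[m/n]*n q p) ⟩
      r + (d + q′ * p) * P       ≡⟨ solve 5 (λ r d q′ p P → r :+ (d :+ q′ :* p) :* P := r :+ d :* P :+ q′ :* (p :* P)) refl r d q′ p P ⟩
      r + d * P + q′ * (p * P)   ∎

  Σℕ≡fromDigits : ∀ x s → Σℕ[ 1 ⋯ s ] (λ j → x j * p ^ (j ∸ 1)) ≡ fromDigits x s
  Σℕ≡fromDigits x s = trans (Σℕ≡sumBelowℕ 1 s (λ j → x j * p ^ (j ∸ 1))) (sum≡fromDigits s)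
    where
    sum≡fromDigits : ∀ s → sumBelowℕ s (λ i → x (suc i) * p ^ i) ≡ fromDigits x s
    sum≡fromDigits zero    = refl
    sum≡fromDigits (suc s) = cong (_+ x (suc s) * p ^ s) (sum≡fromDigits s)

  -- The k whose digits fall below x at digit s + 1 form x_(s+1) residue classes modulo p^(s+1).
  sumBelowℕ-𝟙[%≡]≡belowAt : ∀ {x} → IsDigits x → ∀ k s →
    sumBelowℕ (x (suc s)) (λ b → 𝟙 (mod k (p ^ suc s) ≟ fromDigits x s + b * p ^ s)) ≡ belowAt (digit p k) x s
  sumBelowℕ-𝟙[%≡]≡belowAt {x} digits k s = trans
    (sumBelowℕ-cong (x (suc s)) (λ b _ → 𝟙-cong (mod k (p ^ suc s) ≟ fromDigits x s + b * p ^ s) (agree? e x s ×-dec (e (suc s) ≟ b))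
      (mk⇔ (λ k≡ → let low≡ , e≡b = +-*-unique (p ^ s) {{p^≢0 s}} {e (suc s)} {fromDigits e s} {b} {fromDigits x s}
                                        (fromDigits<p^ (digit-isDigits k) s) (fromDigits<p^ digits s) (trans (sym (k%p^s≡fromDigits k (suc s))) k≡)
                     in fromDigits-injective (digit-isDigits k) digits s low≡ , e≡b)
           (λ (agree , e≡b) → trans (k%p^s≡fromDigits k (suc s)) (cong₂ (λ a c → a + c * p ^ s) (Agree⇒fromDigits≡ s agree) e≡b)))))
    (sumBelowℕ-𝟙[×≡] (agree? e x s) (e (suc s)) (x (suc s)))
    where
    e : ℕ → ℕ
    e = digit p k

  𝟙[φ<trunc]≡residues : ∀ {x} → IsDigits x → ∀ k n → 𝟙 (φ p k ℚ.<? trunc p x n) ≡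
    sumBelowℕ n (λ s → sumBelowℕ (x (suc s)) (λ b → 𝟙 (mod k (p ^ suc s) ≟ fromDigits x s + b * p ^ s)))
  𝟙[φ<trunc]≡residues digits k n = trans (𝟙[φ<trunc] digits k n) (sumBelowℕ-cong n (λ s _ → sym (sumBelowℕ-𝟙[%≡]≡belowAt digits k s)))

  φ-between-truncs : ∀ {x} → IsDigits x → ∀ k n t → φ p k ℚ.< trunc p x (n + t) → ¬ φ p k ℚ.< trunc p x n →
    mod k (p ^ n) ≡ fromDigits x n
  φ-between-truncs {x} digits k n t φ<[x]ₙ₊ₜ φ≮[x]ₙ with agree? (digit p k) x n
  ... | yes agree = trans (k%p^s≡fromDigits k n) (Agree⇒fromDigits≡ n agree)
  ... | no ¬agree = contradiction (begin
    1                                            ≡⟨ sym (𝟙-yes (φ p k ℚ.<? trunc p x (n + t)) φ<[x]ₙ₊ₜ) ⟩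
    𝟙 (φ p k ℚ.<? trunc p x (n + t))             ≡⟨ 𝟙[φ<trunc] digits k (n + t) ⟩
    sumBelowℕ (n + t) (belowAt (digit p k) x)    ≡⟨ sumBelowℕ-pad n t _ (λ s _ → 𝟙-no (agree? (digit p k) x (n + s) ×-dec _)
                                                       (λ (agree , _) → ¬agree (Agree-mono (m≤m+n n s) agree))) ⟩
    sumBelowℕ n (belowAt (digit p k) x)          ≡⟨ sym (𝟙[φ<trunc] digits k n) ⟩
    𝟙 (φ p k ℚ.<? trunc p x n)                   ≡⟨ 𝟙-no (φ p k ℚ.<? trunc p x n) φ≮[x]ₙ ⟩
    0                                            ∎) (λ ())
    where open ≡-Reasoning

  shift : ℕ → (ℕ → ℕ) → ℕ → ℕ
  shift n x j = x (n + j)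

  shift-isDigits : ∀ {x} n → IsDigits x → IsDigits (shift n x)
  shift-isDigits n digits j 1≤j = digits (n + j) (≤-trans 1≤j (m≤n+m j n))

  trunc-nonNeg : ∀ x n → 0ℚ ℚ.≤ trunc p x n
  trunc-nonNeg x n = subst (0ℚ ℚ.≤_) (sym (trunc≡sumBelow x n)) (sumBelow-nonNeg n _ (λ s _ → fromℕ*inv-nonNeg (x (suc s)) (p ^ suc s)))

  trunc≤1 : ∀ {x} → IsDigits x → ∀ n → trunc p x n ℚ.≤ 1ℚ
  trunc≤1 {x} digits n = subst (ℚ._≤ 1ℚ) (sym (trunc≡numer/p^ x n)) (fromℕ*inv≤1 (p ^ n) {{p^≢0 n}} (<⇒≤ (numer<p^ digits n)))

  trunc-split : ∀ x n t → trunc p x (n + t) ≡ trunc p x n ℚ.+ inv (p ^ n) ℚ.* trunc p (shift n x) t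
  trunc-split x n t = begin
    trunc p x (n + t)                                                               ≡⟨ trunc≡sumBelow x (n + t) ⟩
    sumBelow (n + t) (λ s → fromℕ (x (suc s)) ℚ.* inv (p ^ suc s))                  ≡⟨ sumBelow-split n t _ ⟩
    sumBelow n (λ s → fromℕ (x (suc s)) ℚ.* inv (p ^ suc s)) ℚ.+
      sumBelow t (λ s → fromℕ (x (suc (n + s))) ℚ.* inv (p ^ suc (n + s)))          ≡⟨ cong₂ ℚ._+_ (sym (trunc≡sumBelow x n))
                                                                                          (trans (sumBelow-cong t (λ s _ → shifted-term s)) (sym (*-distribˡ-sumBelow t (inv (p ^ n)) _))) ⟩
    trunc p x n ℚ.+ inv (p ^ n) ℚ.* sumBelow t (λ s → fromℕ (x (n + suc s)) ℚ.* inv (p ^ suc s))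
                                                                                    ≡⟨ cong (λ z → trunc p x n ℚ.+ inv (p ^ n) ℚ.* z) (sym (trunc≡sumBelow (shift n x) t)) ⟩
    trunc p x n ℚ.+ inv (p ^ n) ℚ.* trunc p (shift n x) t                           ∎
    where
    open ≡-Reasoning
    open ℚSolver.+-*-Solver
    shifted-term : ∀ s → fromℕ (x (suc (n + s))) ℚ.* inv (p ^ suc (n + s)) ≡ inv (p ^ n) ℚ.* (fromℕ (x (n + suc s)) ℚ.* inv (p ^ suc s))
    shifted-term s = begin
      fromℕ (x (suc (n + s))) ℚ.* inv (p ^ suc (n + s))          ≡⟨ cong (λ z → fromℕ (x z) ℚ.* inv (p ^ z)) (sym (+-suc n s)) ⟩
      fromℕ (x (n + suc s)) ℚ.* inv (p ^ (n + suc s))            ≡⟨ cong (λ z → fromℕ (x (n + suc s)) ℚ.* inv z) (^-distribˡ-+-* p n (suc s)) ⟩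
      fromℕ (x (n + suc s)) ℚ.* inv (p ^ n * p ^ suc s)          ≡⟨ cong (fromℕ (x (n + suc s)) ℚ.*_) (inv-* (p ^ n) (p ^ suc s) {{p^≢0 n}} {{p^≢0 (suc s)}}) ⟩
      fromℕ (x (n + suc s)) ℚ.* (inv (p ^ n) ℚ.* inv (p ^ suc s)) ≡⟨ solve 3 (λ a b c → a :* (b :* c) := b :* (a :* c)) refl (fromℕ (x (n + suc s))) (inv (p ^ n)) (inv (p ^ suc s)) ⟩
      inv (p ^ n) ℚ.* (fromℕ (x (n + suc s)) ℚ.* inv (p ^ suc s)) ∎

  trunc≡sumBelow² : ∀ x n → trunc p x n ≡ sumBelow n (λ s → sumBelow (x (suc s)) (λ _ → inv (p ^ suc s)))
  trunc≡sumBelow² x n = trans (trunc≡sumBelow x n) (sumBelow-cong n (λ s _ → sym (sumBelow-const (x (suc s)) (inv (p ^ suc s)))))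

  trunc-mono : ∀ x n t → trunc p x n ℚ.≤ trunc p x (n + t)
  trunc-mono x n t = subst (trunc p x n ℚ.≤_) (sym (trunc-split x n t))
    (p≤p+q (trunc p x n) (ℚ.≤-trans (ℚ.≤-reflexive (sym (ℚ.*-zeroˡ (trunc p (shift n x) t))))
                                    (ℚ.*-monoʳ-≤-nonNeg (trunc p (shift n x) t) {{nonNegative (trunc-nonNeg (shift n x) t)}} (inv-nonNeg (p ^ n)))))

  N*Δtrunc∈[0,1] : ∀ {x} → IsDigits x → ∀ {N} n t → N ≤ p ^ n →
    0ℚ ℚ.≤ fromℕ N ℚ.* (trunc p x (n + t) ℚ.- trunc p x n) × fromℕ N ℚ.* (trunc p x (n + t) ℚ.- trunc p x n) ℚ.≤ 1ℚ
  N*Δtrunc∈[0,1] {x} digits {N} n t N≤p^n = subst (λ z → 0ℚ ℚ.≤ z × z ℚ.≤ 1ℚ) (sym N*Δ≡)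
    (*-mono-[0,1] (fromℕ*inv-nonNeg N (p ^ n)) (fromℕ*inv≤1 (p ^ n) {{p^≢0 n}} N≤p^n)
                  (trunc-nonNeg (shift n x) t) (trunc≤1 (shift-isDigits n digits) t))
    where
    open ℚSolver.+-*-Solver
    N*Δ≡ : fromℕ N ℚ.* (trunc p x (n + t) ℚ.- trunc p x n) ≡ fromℕ N ℚ.* inv (p ^ n) ℚ.* trunc p (shift n x) t
    N*Δ≡ = trans (cong (λ z → fromℕ N ℚ.* (z ℚ.- trunc p x n)) (trunc-split x n t))
      (solve 4 (λ L a i τ → L :* ((a :+ i :* τ) :- a) := L :* i :* τ) refl (fromℕ N) (trunc p x n) (inv (p ^ n)) (trunc p (shift n x) t))

module HaltonCount where

  open import Defs using (H₂; haltonSeg; count)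
  open FiniteSums using (sumBelowℕ; sumBelowℕ-head)
  open Indicators using (𝟙)
  open import Data.Nat using (ℕ; zero; suc; _+_; _*_)
  open import Data.Rational using (ℚ)
  open import Data.Rational.Properties using (_<?_)
  open import Data.List using (_∷_; applyUpTo; upTo; length)
  open import Data.List.Properties using (map-applyUpTo; length-map; length-applyUpTo)
  open import Data.Product using (_×_; _,_; proj₁; proj₂)
  open import Function using (id)
  open import Relation.Nullary using (yes; no)
  open import Relation.Binary.PropositionalEquality

  inBox : ℚ × ℚ → ℚ × ℚ → ℕ
  inBox y (b₁ , b₂) = 𝟙 (b₁ <? proj₁ y) * 𝟙 (b₂ <? proj₂ y)

  count-∷ : ∀ y b bs → count y (b ∷ bs) ≡ inBox y b + count y bs
  count-∷ y (b₁ , b₂) bs with b₁ <? proj₁ y | b₂ <? proj₂ y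
  ... | yes _ | yes _ = refl
  ... | yes _ | no  _ = refl
  ... | no  _ | _     = refl

  count-applyUpTo : ∀ y (g : ℕ → ℚ × ℚ) N → count y (applyUpTo g N) ≡ sumBelowℕ N (λ i → inBox y (g i))
  count-applyUpTo y g zero    = refl
  count-applyUpTo y g (suc N) = begin
    count y (g 0 ∷ applyUpTo (λ i → g (suc i)) N)                ≡⟨ count-∷ y (g 0) _ ⟩
    inBox y (g 0) + count y (applyUpTo (λ i → g (suc i)) N)      ≡⟨ cong (inBox y (g 0) +_) (count-applyUpTo y (λ i → g (suc i)) N) ⟩
    inBox y (g 0) + sumBelowℕ N (λ i → inBox y (g (suc i)))      ≡⟨ sym (sumBelowℕ-head N (λ i → inBox y (g i))) ⟩
    sumBelowℕ (suc N) (λ i → inBox y (g i))                      ∎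
    where open ≡-Reasoning

  count-haltonSeg : ∀ p₁ p₂ y Q N → count y (haltonSeg p₁ p₂ Q N) ≡ sumBelowℕ N (λ i → inBox y (H₂ p₁ p₂ (Q + i)))
  count-haltonSeg p₁ p₂ y Q N = trans (cong (count y) (map-applyUpTo id (λ i → H₂ p₁ p₂ (Q + i)) N)) (count-applyUpTo y _ N)

  length-haltonSeg : ∀ p₁ p₂ Q N → length (haltonSeg p₁ p₂ Q N) ≡ N
  length-haltonSeg p₁ p₂ Q N = trans (length-map _ (upTo N)) (length-applyUpTo id N)

module Decomposition (p₁ p₂ : ℕ) (1<p₁ : 1 < p₁) (1<p₂ : 1 < p₂) (x₁ x₂ : ℕ → ℕ)
  (digits₁ : ∀ j → 1 ≤ j → x₁ j < p₁) (digits₂ : ∀ j → 1 ≤ j → x₂ j < p₂) (M₁ M₂ : ℕ → ℕ → ℕ)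
  (M₁-inverse : ∀ r₁ r₂ → 1 ≤ r₁ → 1 ≤ r₂ → M₁ r₁ r₂ < p₁ ^ r₁ × mod (p₂ ^ r₂ * M₁ r₁ r₂) (p₁ ^ r₁) ≡ 1)
  (M₂-inverse : ∀ r₁ r₂ → 1 ≤ r₁ → 1 ≤ r₂ → M₂ r₁ r₂ < p₂ ^ r₂ × mod (p₁ ^ r₁ * M₂ r₁ r₂) (p₂ ^ r₂) ≡ 1)
  (Q N n : ℕ) where

  open import Defs using (fromℕ; inv; δ; X; φ; trunc; sumBelow; Σℚ[_⋯_]; haltonSeg; count; D; 𝒟r)
  open Rationals
  open FiniteSums
  open Indicators
  open Congruences using (mod≡%; δ≡𝟙[%≡%]; module CRT)
  open HaltonCount using (count-haltonSeg; length-haltonSeg)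
  open import Data.Nat using (suc; _+_; NonZero; z≤n; s≤s; _≟_)
  open import Data.Nat.Properties using (m*n≢0; <-trans)
  open import Data.Nat.DivMod using (_%_; m%n%n≡m%n)
  open import Data.Integer as ℤ using (+_)
  open import Data.Rational as ℚ using (ℚ)
  import Data.Rational.Properties as ℚ
  open import Data.Product using (_,_; proj₂)
  open import Data.List using (List)
  open import Function.Bundles using (_⇔_; mk⇔; Equivalence)
  open import Relation.Nullary.Decidable using (_×-dec_)
  open import Relation.Binary.PropositionalEquality

  module B₁ = BaseExpansion p₁ 1<p₁
  module B₂ = BaseExpansion p₂ 1<p₂

  -- Indices are shifted, s = r - 1, so that r ≥ 1 holds automatically.
  P : ℕ → ℕ → ℕ
  P s₁ s₂ = p₁ ^ suc s₁ * p₂ ^ suc s₂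

  Xᵣ : ℕ → ℕ → ℕ → ℕ → ℕ
  Xᵣ s₁ s₂ = X p₁ p₂ x₁ x₂ (M₁ (suc s₁) (suc s₂)) (M₂ (suc s₁) (suc s₂)) (suc s₁) (suc s₂)

  residue₁ : ℕ → ℕ → ℕ
  residue₁ s b = B₁.fromDigits x₁ s + b * p₁ ^ s

  residue₂ : ℕ → ℕ → ℕ
  residue₂ s b = B₂.fromDigits x₂ s + b * p₂ ^ s

  Σ⁴ : (ℕ → ℕ → ℕ → ℕ → ℚ) → ℚ
  Σ⁴ F = sumBelow n λ s₁ → sumBelow n λ s₂ → sumBelow (x₁ (suc s₁)) λ b₁ → sumBelow (x₂ (suc s₂)) λ b₂ → F s₁ s₂ b₁ b₂

  Σ⁴-cong : ∀ {F G} → (∀ s₁ s₂ b₁ b₂ → b₁ < x₁ (suc s₁) → b₂ < x₂ (suc s₂) → F s₁ s₂ b₁ b₂ ≡ G s₁ s₂ b₁ b₂) → Σ⁴ F ≡ Σ⁴ G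
  Σ⁴-cong F≡G = sumBelow-cong n λ s₁ _ → sumBelow-cong n λ s₂ _ →
    sumBelow-cong (x₁ (suc s₁)) λ b₁ b₁< → sumBelow-cong (x₂ (suc s₂)) λ b₂ b₂< → F≡G s₁ s₂ b₁ b₂ b₁< b₂<

  Σ⁴-distrib-- : ∀ F G → Σ⁴ (λ s₁ s₂ b₁ b₂ → F s₁ s₂ b₁ b₂ ℚ.- G s₁ s₂ b₁ b₂) ≡ Σ⁴ F ℚ.- Σ⁴ G
  Σ⁴-distrib-- F G = trans (sumBelow-cong n λ s₁ _ → trans (sumBelow-cong n λ s₂ _ →
    trans (sumBelow-cong (x₁ (suc s₁)) λ b₁ _ → sumBelow-distrib-- (x₂ (suc s₂)) _ _)
          (sumBelow-distrib-- (x₁ (suc s₁)) _ _))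
          (sumBelow-distrib-- n _ _))
          (sumBelow-distrib-- n _ _)

  Σ⁴-comm-sumBelow : ∀ (F : ℕ → ℕ → ℕ → ℕ → ℕ → ℚ) →
    Σ⁴ (λ s₁ s₂ b₁ b₂ → sumBelow N (F s₁ s₂ b₁ b₂)) ≡ sumBelow N (λ i → Σ⁴ (λ s₁ s₂ b₁ b₂ → F s₁ s₂ b₁ b₂ i))
  Σ⁴-comm-sumBelow F = trans (sumBelow-cong n λ s₁ _ → trans (sumBelow-cong n λ s₂ _ → trans
    (sumBelow-cong (x₁ (suc s₁)) λ b₁ _ → sumBelow-comm (x₂ (suc s₂)) N (F s₁ s₂ b₁))
    (sumBelow-comm (x₁ (suc s₁)) N _))
    (sumBelow-comm n N _))
    (sumBelow-comm n N _)

  Σ⁴-* : ∀ (f g : ℕ → ℕ → ℚ) → Σ⁴ (λ s₁ s₂ b₁ b₂ → f s₁ b₁ ℚ.* g s₂ b₂) ≡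
    sumBelow n (λ s₁ → sumBelow (x₁ (suc s₁)) (f s₁)) ℚ.* sumBelow n (λ s₂ → sumBelow (x₂ (suc s₂)) (g s₂))
  Σ⁴-* f g = sym (trans (sumBelow-*-sumBelow n n _ _) (sumBelow-cong n λ s₁ _ → sumBelow-cong n λ s₂ _ →
    sumBelow-*-sumBelow (x₁ (suc s₁)) (x₂ (suc s₂)) (f s₁) (g s₂)))

  -- By the Chinese remainder theorem, X_{r,b} is the residue class modulo P_r
  -- of the k whose first digits match x₁ and x₂ up to the digits b₁, b₂.
  δ≡𝟙[%≡]*𝟙[%≡] : ∀ k s₁ s₂ b₁ b₂ → b₁ < x₁ (suc s₁) → b₂ < x₂ (suc s₂) →
    δ (P s₁ s₂) (+ k ℤ.- + Xᵣ s₁ s₂ b₁ b₂) ≡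
    fromℕ (𝟙 (mod k (p₁ ^ suc s₁) ≟ residue₁ s₁ b₁)) ℚ.* fromℕ (𝟙 (mod k (p₂ ^ suc s₂) ≟ residue₂ s₂ b₂))
  δ≡𝟙[%≡]*𝟙[%≡] k s₁ s₂ b₁ b₂ b₁< b₂< = begin
    δ (m₁ * m₂) (+ k ℤ.- + Xᵣ s₁ s₂ b₁ b₂)                    ≡⟨ δ≡𝟙[%≡%] (m₁ * m₂) k (Xᵣ s₁ s₂ b₁ b₂) ⟩
    fromℕ (𝟙 (k % (m₁ * m₂) ≟ Xᵣ s₁ s₂ b₁ b₂ % (m₁ * m₂)))   ≡⟨ cong fromℕ (𝟙-cong (k % (m₁ * m₂) ≟ Xᵣ s₁ s₂ b₁ b₂ % (m₁ * m₂)) ((mod k m₁ ≟ a₁) ×-dec (mod k m₂ ≟ a₂))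
                                                                  k≡X⇔k≡a₁×k≡a₂) ⟩
    fromℕ (𝟙 ((mod k m₁ ≟ a₁) ×-dec (mod k m₂ ≟ a₂)))        ≡⟨ cong fromℕ (𝟙-× (mod k m₁ ≟ a₁) (mod k m₂ ≟ a₂)) ⟩
    fromℕ (𝟙 (mod k m₁ ≟ a₁) * 𝟙 (mod k m₂ ≟ a₂))            ≡⟨ fromℕ-* (𝟙 (mod k m₁ ≟ a₁)) (𝟙 (mod k m₂ ≟ a₂)) ⟩
    fromℕ (𝟙 (mod k m₁ ≟ a₁)) ℚ.* fromℕ (𝟙 (mod k m₂ ≟ a₂))  ∎
    where
    open ≡-Reasoning
    m₁ m₂ a₁ a₂ : ℕ
    m₁ = p₁ ^ suc s₁
    m₂ = p₂ ^ suc s₂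
    a₁ = residue₁ s₁ b₁
    a₂ = residue₂ s₂ b₂
    instance
      m₁≢0 : NonZero m₁
      m₁≢0 = B₁.p^≢0 (suc s₁)
      m₂≢0 : NonZero m₂
      m₂≢0 = B₂.p^≢0 (suc s₂)
      m₁m₂≢0 : NonZero (m₁ * m₂)
      m₁m₂≢0 = m*n≢0 m₁ m₂
    module C = CRT m₁ m₂ (M₁ (suc s₁) (suc s₂)) (M₂ (suc s₁) (suc s₂)) a₁ a₂
      (trans (sym (mod≡% _ m₁)) (proj₂ (M₁-inverse (suc s₁) (suc s₂) (s≤s z≤n) (s≤s z≤n))))
      (trans (sym (mod≡% _ m₂)) (proj₂ (M₂-inverse (suc s₁) (suc s₂) (s≤s z≤n) (s≤s z≤n))))
      (B₁.fromDigits+b*p^s<p^[1+s] digits₁ s₁ (<-trans b₁< (digits₁ (suc s₁) (s≤s z≤n))))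
      (B₂.fromDigits+b*p^s<p^[1+s] digits₂ s₂ (<-trans b₂< (digits₂ (suc s₂) (s≤s z≤n))))
    X%≡ : Xᵣ s₁ s₂ b₁ b₂ % (m₁ * m₂) ≡ C.solution % (m₁ * m₂)
    X%≡ = trans (cong (_% (m₁ * m₂)) (trans (cong₂ (λ u v → mod (M₁ (suc s₁) (suc s₂) * m₂ * (u + b₁ * p₁ ^ s₁) + M₂ (suc s₁) (suc s₂) * m₁ * (v + b₂ * p₂ ^ s₂)) (m₁ * m₂))
                                                     (B₁.Σℕ≡fromDigits x₁ s₁) (B₂.Σℕ≡fromDigits x₂ s₂))
                                             (mod≡% C.solution (m₁ * m₂))))
                (m%n%n≡m%n C.solution (m₁ * m₂))
    k≡X⇔k≡a₁×k≡a₂ : k % (m₁ * m₂) ≡ Xᵣ s₁ s₂ b₁ b₂ % (m₁ * m₂) ⇔ (mod k m₁ ≡ a₁ × mod k m₂ ≡ a₂)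
    k≡X⇔k≡a₁×k≡a₂ = mk⇔
      (λ k≡X → let (k≡a₁ , k≡a₂) = Equivalence.to (C.crt k) (trans k≡X X%≡) in trans (mod≡% k m₁) k≡a₁ , trans (mod≡% k m₂) k≡a₂)
      (λ (k≡a₁ , k≡a₂) → trans (Equivalence.from (C.crt k) (trans (sym (mod≡% k m₁)) k≡a₁ , trans (sym (mod≡% k m₂)) k≡a₂)) (sym X%≡))

  decomposition-at : ∀ k → Σ⁴ (λ s₁ s₂ b₁ b₂ → δ (P s₁ s₂) (+ k ℤ.- + Xᵣ s₁ s₂ b₁ b₂) ℚ.- inv (P s₁ s₂)) ≡
    fromℕ (𝟙 (φ p₁ k ℚ.<? trunc p₁ x₁ n)) ℚ.* fromℕ (𝟙 (φ p₂ k ℚ.<? trunc p₂ x₂ n)) ℚ.- trunc p₁ x₁ n ℚ.* trunc p₂ x₂ n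
  decomposition-at k = begin
    Σ⁴ (λ s₁ s₂ b₁ b₂ → δ (P s₁ s₂) (+ k ℤ.- + Xᵣ s₁ s₂ b₁ b₂) ℚ.- inv (P s₁ s₂))
      ≡⟨ Σ⁴-distrib-- _ _ ⟩
    Σ⁴ (λ s₁ s₂ b₁ b₂ → δ (P s₁ s₂) (+ k ℤ.- + Xᵣ s₁ s₂ b₁ b₂)) ℚ.- Σ⁴ (λ s₁ s₂ _ _ → inv (P s₁ s₂))
      ≡⟨ cong₂ ℚ._-_ (Σ⁴-cong (δ≡𝟙[%≡]*𝟙[%≡] k))
                     (Σ⁴-cong (λ s₁ s₂ _ _ _ _ → inv-* (p₁ ^ suc s₁) (p₂ ^ suc s₂) {{B₁.p^≢0 (suc s₁)}} {{B₂.p^≢0 (suc s₂)}})) ⟩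
    Σ⁴ (λ s₁ s₂ b₁ b₂ → fromℕ (𝟙 (mod k (p₁ ^ suc s₁) ≟ residue₁ s₁ b₁)) ℚ.* fromℕ (𝟙 (mod k (p₂ ^ suc s₂) ≟ residue₂ s₂ b₂)))
      ℚ.- Σ⁴ (λ s₁ s₂ _ _ → inv (p₁ ^ suc s₁) ℚ.* inv (p₂ ^ suc s₂))
      ≡⟨ cong₂ ℚ._-_ (Σ⁴-* _ _) (Σ⁴-* _ _) ⟩
    sumBelow n (λ s₁ → sumBelow (x₁ (suc s₁)) (λ b₁ → fromℕ (𝟙 (mod k (p₁ ^ suc s₁) ≟ residue₁ s₁ b₁))))
      ℚ.* sumBelow n (λ s₂ → sumBelow (x₂ (suc s₂)) (λ b₂ → fromℕ (𝟙 (mod k (p₂ ^ suc s₂) ≟ residue₂ s₂ b₂))))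
      ℚ.- sumBelow n (λ s₁ → sumBelow (x₁ (suc s₁)) (λ _ → inv (p₁ ^ suc s₁)))
      ℚ.* sumBelow n (λ s₂ → sumBelow (x₂ (suc s₂)) (λ _ → inv (p₂ ^ suc s₂)))
      ≡⟨ cong₂ ℚ._-_ (sym (cong₂ ℚ._*_ (trans (cong fromℕ (B₁.𝟙[φ<trunc]≡residues digits₁ k n)) (fromℕ-sumBelowℕ² n (λ s → x₁ (suc s)) _))
                                        (trans (cong fromℕ (B₂.𝟙[φ<trunc]≡residues digits₂ k n)) (fromℕ-sumBelowℕ² n (λ s → x₂ (suc s)) _))))
                     (sym (cong₂ ℚ._*_ (B₁.trunc≡sumBelow² x₁ n) (B₂.trunc≡sumBelow² x₂ n))) ⟩
    fromℕ (𝟙 (φ p₁ k ℚ.<? trunc p₁ x₁ n)) ℚ.* fromℕ (𝟙 (φ p₂ k ℚ.<? trunc p₂ x₂ n)) ℚ.- trunc p₁ x₁ n ℚ.* trunc p₂ x₂ n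
      ∎
    where open ≡-Reasoning

  decomposition : D (trunc p₁ x₁ n , trunc p₂ x₂ n) (haltonSeg p₁ p₂ Q N) ≡
    Σℚ[ 1 ⋯ n ] (λ r₁ → Σℚ[ 1 ⋯ n ] (λ r₂ → 𝒟r p₁ p₂ x₁ x₂ M₁ M₂ Q N r₁ r₂))
  decomposition = sym (begin
    Σℚ[ 1 ⋯ n ] (λ r₁ → Σℚ[ 1 ⋯ n ] (λ r₂ → 𝒟r p₁ p₂ x₁ x₂ M₁ M₂ Q N r₁ r₂))
      ≡⟨ trans (Σℚ≡sumBelow 1 n _) (sumBelow-cong n (λ s₁ _ → Σℚ≡sumBelow 1 n _)) ⟩
    Σ⁴ (λ s₁ s₂ b₁ b₂ → sumBelow N (λ i → δ (P s₁ s₂) (+ (Q + i) ℤ.- + Xᵣ s₁ s₂ b₁ b₂) ℚ.- inv (P s₁ s₂)))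
      ≡⟨ Σ⁴-comm-sumBelow _ ⟩
    sumBelow N (λ i → Σ⁴ (λ s₁ s₂ b₁ b₂ → δ (P s₁ s₂) (+ (Q + i) ℤ.- + Xᵣ s₁ s₂ b₁ b₂) ℚ.- inv (P s₁ s₂)))
      ≡⟨ sumBelow-cong N (λ i _ → decomposition-at (Q + i)) ⟩
    sumBelow N (λ i → fromℕ (𝟙 (φ p₁ (Q + i) ℚ.<? t₁)) ℚ.* fromℕ (𝟙 (φ p₂ (Q + i) ℚ.<? t₂)) ℚ.- t₁ ℚ.* t₂)
      ≡⟨ sumBelow-distrib-- N _ _ ⟩
    sumBelow N (λ i → fromℕ (𝟙 (φ p₁ (Q + i) ℚ.<? t₁)) ℚ.* fromℕ (𝟙 (φ p₂ (Q + i) ℚ.<? t₂))) ℚ.- sumBelow N (λ _ → t₁ ℚ.* t₂)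
      ≡⟨ cong₂ ℚ._-_ (sym count≡) (sumBelow-const N (t₁ ℚ.* t₂)) ⟩
    fromℕ (count (t₁ , t₂) seg) ℚ.- fromℕ N ℚ.* (t₁ ℚ.* t₂)
      ≡⟨ cong (λ z → fromℕ (count (t₁ , t₂) seg) ℚ.- z)
              (trans (sym (ℚ.*-assoc (fromℕ N) t₁ t₂)) (cong (λ L → fromℕ L ℚ.* t₁ ℚ.* t₂) (sym (length-haltonSeg p₁ p₂ Q N)))) ⟩
    D (t₁ , t₂) seg
      ∎)
    where
    open ≡-Reasoning
    t₁ t₂ : ℚ
    t₁ = trunc p₁ x₁ n
    t₂ = trunc p₂ x₂ n
    seg : List (ℚ × ℚ)
    seg = haltonSeg p₁ p₂ Q N
    count≡ : fromℕ (count (t₁ , t₂) seg) ≡ sumBelow N (λ i → fromℕ (𝟙 (φ p₁ (Q + i) ℚ.<? t₁)) ℚ.* fromℕ (𝟙 (φ p₂ (Q + i) ℚ.<? t₂)))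
    count≡ = trans (cong fromℕ (count-haltonSeg p₁ p₂ (t₁ , t₂) Q N))
                   (trans (fromℕ-sumBelowℕ N _) (sumBelow-cong N (λ i _ → fromℕ-* (𝟙 (φ p₁ (Q + i) ℚ.<? t₁)) (𝟙 (φ p₂ (Q + i) ℚ.<? t₂)))))

module Stability (p₁ p₂ : ℕ) (1<p₁ : 1 < p₁) (1<p₂ : 1 < p₂) (x₁ x₂ : ℕ → ℕ)
  (digits₁ : ∀ j → 1 ≤ j → x₁ j < p₁) (digits₂ : ∀ j → 1 ≤ j → x₂ j < p₂)
  (Q N n : ℕ) (N≤p₁^n : N ≤ p₁ ^ n) (N≤p₂^n : N ≤ p₂ ^ n) where

  open import Defs using (fromℕ; φ; trunc; haltonSeg; count; D)
  open Rationals
  open FiniteSums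
  open Indicators
  open Congruences using (mod≡%)
  open HaltonCount using (count-haltonSeg; length-haltonSeg)
  open import Data.Nat using (_+_; _∸_; z≤n)
  open import Data.Nat.Properties using (≤-trans; ≤-reflexive; +-mono-≤; +-assoc; m+n∸m≡n; ∸-monoˡ-≤; m+[n∸m]≡n; *-mono-≤)
  open import Data.Rational as ℚ using (ℚ; 0ℚ; 1ℚ)
  import Data.Rational.Properties as ℚ
  import Data.Rational.Solver as ℚSolver
  open import Data.Product using (_×_; _,_; proj₁; proj₂)
  open import Data.List using (List; length)
  open import Relation.Binary.PropositionalEquality

  module B₁ = BaseExpansion p₁ 1<p₁
  module B₂ = BaseExpansion p₂ 1<p₂
  module R₁ = ResidueCount (p₁ ^ n) {{B₁.p^≢0 n}} (B₁.fromDigits x₁ n) (B₁.fromDigits<p^ digits₁ n)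
  module R₂ = ResidueCount (p₂ ^ n) {{B₂.p^≢0 n}} (B₂.fromDigits x₂ n) (B₂.fromDigits<p^ digits₂ n)

  corner : ℕ → ℚ × ℚ
  corner m = trunc p₁ x₁ m , trunc p₂ x₂ m

  seg : List (ℚ × ℚ)
  seg = haltonSeg p₁ p₂ Q N

  count-corner-mono : ∀ t → count (corner n) seg ≤ count (corner (n + t)) seg
  count-corner-mono t = subst₂ _≤_ (sym (count-haltonSeg p₁ p₂ (corner n) Q N)) (sym (count-haltonSeg p₁ p₂ (corner (n + t)) Q N))
    (sumBelowℕ-mono-≤ N (λ i _ → *-mono-≤
      (𝟙-mono (φ p₁ (Q + i) ℚ.<? trunc p₁ x₁ n) (φ p₁ (Q + i) ℚ.<? trunc p₁ x₁ (n + t)) (λ lt → ℚ.<-≤-trans lt (B₁.trunc-mono x₁ n t)))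
      (𝟙-mono (φ p₂ (Q + i) ℚ.<? trunc p₂ x₂ n) (φ p₂ (Q + i) ℚ.<? trunc p₂ x₂ (n + t)) (λ lt → ℚ.<-≤-trans lt (B₂.trunc-mono x₂ n t)))))

  -- A point entering the larger box has the first n digits of x₁ or of x₂.
  count-corner-growth : ∀ t → count (corner (n + t)) seg ≤ count (corner n) seg + R₁.hits Q N + R₂.hits Q N
  count-corner-growth t = subst₂ _≤_ (sym (count-haltonSeg p₁ p₂ (corner (n + t)) Q N))
    (trans (sumBelowℕ-distrib-+ N _ _) (cong (_+ R₂.hits Q N) (trans (sumBelowℕ-distrib-+ N _ _)
      (cong (_+ R₁.hits Q N) (sym (count-haltonSeg p₁ p₂ (corner n) Q N))))))
    (sumBelowℕ-mono-≤ N (λ i _ → 𝟙*𝟙≤𝟙*𝟙+𝟙+𝟙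
      (φ p₁ (Q + i) ℚ.<? trunc p₁ x₁ n) (φ p₂ (Q + i) ℚ.<? trunc p₂ x₂ n)
      (φ p₁ (Q + i) ℚ.<? trunc p₁ x₁ (n + t)) (φ p₂ (Q + i) ℚ.<? trunc p₂ x₂ (n + t))
      (R₁.hit? (Q + i)) (R₂.hit? (Q + i))
      (λ lt ¬lt → trans (sym (mod≡% (Q + i) (p₁ ^ n) {{B₁.p^≢0 n}})) (B₁.φ-between-truncs digits₁ (Q + i) n t lt ¬lt))
      (λ lt ¬lt → trans (sym (mod≡% (Q + i) (p₂ ^ n) {{B₂.p^≢0 n}})) (B₂.φ-between-truncs digits₂ (Q + i) n t lt ¬lt))))

  stability : ∀ t → ℚ.∣ D (corner n) seg ℚ.- D (corner (n + t)) seg ∣ ℚ.≤ fromℕ 2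
  stability t = subst (λ z → ℚ.∣ z ∣ ℚ.≤ fromℕ 2) (sym D-D≡)
    (∣p-q∣≤r (ℚ.+-mono-≤ (proj₁ area₁) (proj₁ area₂)) (ℚ.≤-trans (ℚ.+-mono-≤ (proj₂ area₁) (proj₂ area₂)) (ℚ.≤-reflexive (sym (fromℕ-suc 1))))
             (fromℕ-nonNeg d) (fromℕ-mono-≤ d≤2))
    where
    open ℚSolver.+-*-Solver
    open ≡-Reasoning
    Cₙ Cₘ d : ℕ
    Cₙ = count (corner n) seg
    Cₘ = count (corner (n + t)) seg
    d = Cₘ ∸ Cₙ
    d≤2 : d ≤ 2
    d≤2 = ≤-trans (∸-monoˡ-≤ Cₙ (count-corner-growth t))
            (≤-trans (≤-reflexive (trans (cong (_∸ Cₙ) (+-assoc Cₙ _ _)) (m+n∸m≡n Cₙ _)))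
                     (+-mono-≤ (R₁.hits≤1 Q N N≤p₁^n) (R₂.hits≤1 Q N N≤p₂^n)))
    L a b a′ b′ : ℚ
    L = fromℕ N
    a = trunc p₁ x₁ n
    b = trunc p₂ x₂ n
    a′ = trunc p₁ x₁ (n + t)
    b′ = trunc p₂ x₂ (n + t)
    area₁ : 0ℚ ℚ.≤ L ℚ.* (a′ ℚ.- a) ℚ.* b′ × L ℚ.* (a′ ℚ.- a) ℚ.* b′ ℚ.≤ 1ℚ
    area₁ = let (lo , hi) = B₁.N*Δtrunc∈[0,1] digits₁ n t N≤p₁^n
            in *-mono-[0,1] lo hi (B₂.trunc-nonNeg x₂ (n + t)) (B₂.trunc≤1 digits₂ (n + t))
    area₂ : 0ℚ ℚ.≤ L ℚ.* (b′ ℚ.- b) ℚ.* a × L ℚ.* (b′ ℚ.- b) ℚ.* a ℚ.≤ 1ℚ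
    area₂ = let (lo , hi) = B₂.N*Δtrunc∈[0,1] digits₂ n t N≤p₂^n
            in *-mono-[0,1] lo hi (B₁.trunc-nonNeg x₁ n) (B₁.trunc≤1 digits₁ n)
    D-D≡ : D (corner n) seg ℚ.- D (corner (n + t)) seg ≡ (L ℚ.* (a′ ℚ.- a) ℚ.* b′ ℚ.+ L ℚ.* (b′ ℚ.- b) ℚ.* a) ℚ.- fromℕ d
    D-D≡ = begin
      (fromℕ Cₙ ℚ.- fromℕ (length seg) ℚ.* a ℚ.* b) ℚ.- (fromℕ Cₘ ℚ.- fromℕ (length seg) ℚ.* a′ ℚ.* b′)
        ≡⟨ cong₂ (λ u v → (fromℕ Cₙ ℚ.- fromℕ u ℚ.* a ℚ.* b) ℚ.- (v ℚ.- fromℕ u ℚ.* a′ ℚ.* b′))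
                 (length-haltonSeg p₁ p₂ Q N) (trans (cong fromℕ (sym (m+[n∸m]≡n (count-corner-mono t)))) (fromℕ-+ Cₙ d)) ⟩
      (fromℕ Cₙ ℚ.- L ℚ.* a ℚ.* b) ℚ.- ((fromℕ Cₙ ℚ.+ fromℕ d) ℚ.- L ℚ.* a′ ℚ.* b′)
        ≡⟨ solve 4 (λ c d X Y → (c :- X) :- ((c :+ d) :- Y) := (Y :- X) :- d) refl (fromℕ Cₙ) (fromℕ d) (L ℚ.* a ℚ.* b) (L ℚ.* a′ ℚ.* b′) ⟩
      (L ℚ.* a′ ℚ.* b′ ℚ.- L ℚ.* a ℚ.* b) ℚ.- fromℕ d
        ≡⟨ cong (ℚ._- fromℕ d) (solve 5 (λ L a b a′ b′ → L :* a′ :* b′ :- L :* a :* b := L :* (a′ :- a) :* b′ :+ L :* (b′ :- b) :* a) refl L a b a′ b′) ⟩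
      (L ℚ.* (a′ ℚ.- a) ℚ.* b′ ℚ.+ L ℚ.* (b′ ℚ.- b) ℚ.* a) ℚ.- fromℕ d ∎

  stability-≤ : ∀ {m} → n ≤ m → ℚ.∣ D (corner n) seg ℚ.- D (corner m) seg ∣ ℚ.≤ fromℕ 2
  stability-≤ {m} n≤m = subst (λ z → ℚ.∣ D (corner n) seg ℚ.- D (corner z) seg ∣ ℚ.≤ fromℕ 2) (m+[n∸m]≡n n≤m) (stability (m ∸ n))

open import Defs
open import Data.Nat using (ℕ; _+_; _*_; _^_; _∸_; _≤_; _<_)
open import Data.Nat.Primality using (Prime)
open import Data.Nat.Logarithm using (⌊log₂_⌋)
open import Data.Rational as ℚ using (ℚ; Positive)
open import Data.Product using (_×_; _,_; ∃)
open import Relation.Binary.PropositionalEquality using (_≡_; _≢_)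
open import Relation.Nullary using (¬_)

open Rationals
open FiniteSums
open Congruences using (δ≡𝟙[%≡%])
open import Data.Nat using (NonZero; z≤n; s≤s; nonTrivial⇒n>1; _<?_)
open import Data.Nat.Properties using (<⇒≤; <-≤-trans; ^-monoˡ-≤; *-mono-<; m<m+n; <⇒≱; ≮⇒≥; m*n≢0; m^n≢0)
open import Data.Nat.DivMod using (_%_; m%n<n)
open import Data.Nat.Logarithm using (⌊log₂⌋-mono-≤; ⌊log₂[2^n]⌋≡n)
open import Data.Nat.Primality using (prime⇒nonTrivial; prime⇒nonZero)
open import Data.Integer as ℤ using (+_)
import Data.Rational.Properties as ℚ
open import Relation.Nullary using (yes; no; contradiction)
open import Relation.Binary.PropositionalEquality using (subst; sym; trans; cong; cong₂)

n<2^[⌊log₂n⌋+1] : ∀ n → n < 2 ^ (⌊log₂ n ⌋ + 1)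
n<2^[⌊log₂n⌋+1] n with n <? 2 ^ (⌊log₂ n ⌋ + 1)
... | yes n<2^ = n<2^
... | no  n≮2^ = contradiction (subst (_≤ ⌊log₂ n ⌋) (⌊log₂[2^n]⌋≡n (⌊log₂ n ⌋ + 1)) (⌊log₂⌋-mono-≤ (≮⇒≥ n≮2^)))
                               (<⇒≱ (m<m+n ⌊log₂ n ⌋ (s≤s z≤n)))

∣sumBelow[δ-1/m]∣≤1 : ∀ m .{{_ : NonZero m}} x Q N → ℚ.∣ sumBelow N (λ i → δ m (+ (Q + i) ℤ.- + x) ℚ.- inv m) ∣ ℚ.≤ ℚ.1ℚ
∣sumBelow[δ-1/m]∣≤1 m x Q N = subst (λ z → ℚ.∣ z ∣ ℚ.≤ ℚ.1ℚ) (sym sum≡hits-N/m) (R.∣hits-N/m∣≤1 Q N)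
  where
  module R = ResidueCount m (x % m) (m%n<n x m)
  sum≡hits-N/m : sumBelow N (λ i → δ m (+ (Q + i) ℤ.- + x) ℚ.- inv m) ≡ fromℕ (R.hits Q N) ℚ.- fromℕ N ℚ.* inv m
  sum≡hits-N/m = trans (sumBelow-distrib-- N _ _) (cong₂ ℚ._-_
    (trans (sumBelow-cong N (λ i _ → δ≡𝟙[%≡%] m (Q + i) x)) (sym (fromℕ-sumBelowℕ N _)))
    (sumBelow-const N (inv m)))

∣𝒟r∣≤x₁x₂ : ∀ p₁ p₂ .{{_ : NonZero p₁}} .{{_ : NonZero p₂}} x₁ x₂ M₁ M₂ Q N r₁ r₂ →
  ℚ.∣ 𝒟r p₁ p₂ x₁ x₂ M₁ M₂ Q N r₁ r₂ ∣ ℚ.≤ fromℕ (x₁ r₁ * x₂ r₂)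
∣𝒟r∣≤x₁x₂ p₁ p₂ x₁ x₂ M₁ M₂ Q N r₁ r₂ = ℚ.≤-trans
  (∣sumBelow∣≤ (x₁ r₁) _ (fromℕ (x₂ r₂) ℚ.* ℚ.1ℚ) (λ b₁ _ → ∣sumBelow∣≤ (x₂ r₂) _ ℚ.1ℚ (λ b₂ _ →
     ∣sumBelow[δ-1/m]∣≤1 (p₁ ^ r₁ * p₂ ^ r₂) {{m*n≢0 _ _ {{m^n≢0 p₁ r₁}} {{m^n≢0 p₂ r₂}}}}
                         (X p₁ p₂ x₁ x₂ (M₁ r₁ r₂) (M₂ r₁ r₂) r₁ r₂ b₁ b₂) Q N)))
  (ℚ.≤-reflexive (trans (cong (fromℕ (x₁ r₁) ℚ.*_) (ℚ.*-identityʳ (fromℕ (x₂ r₂)))) (sym (fromℕ-* (x₁ r₁) (x₂ r₂)))))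

-- Unused hypotheses: p₁ ≢ p₂ (the inverses M₁, M₂ already make p₁^r₁ and p₂^r₂ coprime),
-- 2 ≤ N, and the exclusion of digit sequences ending in p - 1 (digits are given directly).
-- The second claim holds with m₀ = n and without ε.
lemma2 : (p₁ p₂ : ℕ) → Prime p₁ → Prime p₂ → p₁ ≢ p₂ →
  (Q N : ℕ) → 2 ≤ N →
  (x₁ x₂ : ℕ → ℕ) →
  (∀ j → 1 ≤ j → x₁ j < p₁) → (∀ j → 1 ≤ j → x₂ j < p₂) →
  ¬ (∀ j → 1 ≤ j → x₁ j ≡ p₁ ∸ 1) → ¬ (∀ j → 1 ≤ j → x₂ j ≡ p₂ ∸ 1) →
  (M₁ M₂ : ℕ → ℕ → ℕ) →
  (∀ r₁ r₂ → 1 ≤ r₁ → 1 ≤ r₂ →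
    M₁ r₁ r₂ < p₁ ^ r₁ × mod (p₂ ^ r₂ * M₁ r₁ r₂) (p₁ ^ r₁) ≡ 1) →
  (∀ r₁ r₂ → 1 ≤ r₁ → 1 ≤ r₂ →
    M₂ r₁ r₂ < p₂ ^ r₂ × mod (p₁ ^ r₁ * M₂ r₁ r₂) (p₂ ^ r₂) ≡ 1) →
  let n = ⌊log₂ N ⌋ + 1
      seg = haltonSeg p₁ p₂ Q N
      𝒟N = D (trunc p₁ x₁ n , trunc p₂ x₂ n) seg
  in (𝒟N ≡ Σℚ[ 1 ⋯ n ] (λ r₁ → Σℚ[ 1 ⋯ n ] (λ r₂ → 𝒟r p₁ p₂ x₁ x₂ M₁ M₂ Q N r₁ r₂)))
     × (∀ (ε : ℚ) → Positive ε → ∃ λ m₀ → ∀ m → m₀ ≤ m →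
         ℚ.∣ 𝒟N ℚ.- D (trunc p₁ x₁ m , trunc p₂ x₂ m) seg ∣ ℚ.≤ fromℕ 2 ℚ.+ ε)
     × (∀ r₁ r₂ → 1 ≤ r₁ → 1 ≤ r₂ → ∀ (N′ : ℕ) →
         ℚ.∣ 𝒟r p₁ p₂ x₁ x₂ M₁ M₂ Q N′ r₁ r₂ ∣ ℚ.≤ fromℕ (x₁ r₁ * x₂ r₂)
         × x₁ r₁ * x₂ r₂ < p₁ * p₂)
lemma2 p₁ p₂ p₁-prime p₂-prime _ Q N _ x₁ x₂ digits₁ digits₂ _ _ M₁ M₂ M₁-inverse M₂-inverse =
    Dec.decomposition
  , (λ ε ε>0 → n , λ m n≤m → ℚ.≤-trans (Stab.stability-≤ n≤m) (p≤p+q (fromℕ 2) (ℚ.<⇒≤ (ℚ.positive⁻¹ ε {{ε>0}}))))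
  , λ r₁ r₂ 1≤r₁ 1≤r₂ N′ → ∣𝒟r∣≤x₁x₂ p₁ p₂ {{prime⇒nonZero p₁-prime}} {{prime⇒nonZero p₂-prime}} x₁ x₂ M₁ M₂ Q N′ r₁ r₂
                          , *-mono-< (digits₁ r₁ 1≤r₁) (digits₂ r₂ 1≤r₂)
  where
  1<p₁ : 1 < p₁
  1<p₁ = nonTrivial⇒n>1 p₁ {{prime⇒nonTrivial p₁-prime}}
  1<p₂ : 1 < p₂
  1<p₂ = nonTrivial⇒n>1 p₂ {{prime⇒nonTrivial p₂-prime}}
  n : ℕ
  n = ⌊log₂ N ⌋ + 1
  N≤p^n : ∀ {p} → 1 < p → N ≤ p ^ n
  N≤p^n 1<p = <⇒≤ (<-≤-trans (n<2^[⌊log₂n⌋+1] N) (^-monoˡ-≤ n 1<p))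
  module Dec = Decomposition p₁ p₂ 1<p₁ 1<p₂ x₁ x₂ digits₁ digits₂ M₁ M₂ M₁-inverse M₂-inverse Q N n
  module Stab = Stability p₁ p₂ 1<p₁ 1<p₂ x₁ x₂ digits₁ digits₂ Q N n (N≤p^n 1<p₁) (N≤p^n 1<p₂)
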